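{- Let $d\geq 4$ and let $\Sigma$ be the simplicial complex constructed below. Then the group $\mathbb{Z}_2\times \mathcal{D}_{2d}$, where $\mathcal{D}_{2d}$ is the dihedral group of order $4d$, acts on $\Sigma$ by simplicial automorphisms; i.e. the automorphism group of $\Sigma$ contains a subgroup isomorphic to $\mathbb{Z}_2\times\mathcal{D}_{2d}$.
   Context: Construction of $\Sigma$. Use vertices $x_1,\dots,x_d,y_1,\dots,y_d,x'_1,\dots,x'_d,y'_1,\dots,y'_d$, with indices cyclic ($x_{d+j}=x_j$ etc.); give $x_j,y_j,x'_j,y'_j$ color $j$. Let $\partial P$ (resp. $\partial P'$) be the boundary complex of the $d$-cross-polytope on $\{x_j,y_j\}$ (resp. $\{x'_j,y'_j\}$), whose faces are subsets containing no pair $\{x_j,y_j\}$ (resp. $\{x'_j,y'_j\}$). For $1\le i\le d$ let $\sigma_i=\{x_1,\dots,x_i,y_{i+1},\dots,y_d\}$ and $\sigma_{d+i}=\{y_1,\dots,y_i,x_{i+1},\dots,x_d\}$; let $\Delta_1\subseteq\partial P$ be generated by $\sigma_1,\dots,\sigma_{2d}$ and $\Delta_2$ by the remaining facets of $\partial P$. Let $f:\partial P\to\partial P'$ be the simplicial isomorphism induced by $x_i\mapsto x'_{i+1}$, $y_i\mapsto y'_{i+1}$ ($1\le i\le d-1$), $x_d\mapsto y'_1$, $y_d\mapsto x'_1$. For $1\le i\le 2d$ let $\Gamma_i$ be the boundary complex of the $d$-cross-polytope on vertex set $\sigma_i\cup f(\sigma_i)$ in which each vertex of $\sigma_i$ is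 antipodal to the vertex of $f(\sigma_i)$ of the same color. Define edges $e_i=\{x'_{i+1},y_{i+2}\}$ and $e_{d+i}=\{y'_{i+1},x_{i+2}\}$ for $1\le i\le d-2$, $e_{d-1}=\{x'_d,x_1\}$, $e_d=\{y'_1,x_2\}$, $e_{2d-1}=\{y'_d,y_1\}$, $e_{2d}=\{x'_1,y_2\}$ (so that $\Gamma_i\cap\Gamma_{i+1}=\mathrm{st}(e_i,\Gamma_i)$, indices mod $2d$). Let $\Gamma$ be the complex generated by all facets of $\Gamma_1,\dots,\Gamma_{2d}$ that contain neither $e_{i-1}$ nor $e_i$ when taken in $\Gamma_i$ (indices mod $2d$); $\Gamma$ contains $\Delta_1$ and $f(\Delta_1)$. Let $N$ be generated by the facets of $\Gamma$ not belonging to $\Delta_1\cup f(\Delta_1)$. Finally $\Sigma$ is the complex generated by the facets of $\Delta_2$, $N$ and $f(\Delta_2)$. -}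

module Defs where

open import Data.Nat using (ℕ; zero; suc; _+_; _∸_; _≤ᵇ_; _<ᵇ_; _≡ᵇ_; NonZero; _≤_)
open import Data.Nat.DivMod using (_mod_)
open import Data.Fin using (Fin; toℕ)
open import Data.Bool using (Bool; true; false; not; if_then_else_; _xor_; _∧_)
open import Data.Product using (Σ; ∃; ∃-syntax; _×_; _,_)
open import Data.Sum using (_⊎_)
open import Relation.Nullary using (¬_)
open import Relation.Binary.PropositionalEquality using (_≡_)
open import Function.Bundles using (_↔_; Inverse)

-- Vertices.  x c, y c, x' c, y' c with c : Fin d.
-- Convention: the element c : Fin d stands for the paper's colour
-- (toℕ c + 1) ∈ {1,…,d}.

data V (d : ℕ) : Set where
  x y x' y' : Fin d → V d

color : ∀ {d} → V d → Fin d
color (x c)  = c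
color (y c)  = c
color (x' c) = c
color (y' c) = c

pc : ∀ {d} → Fin d → ℕ
pc c = suc (toℕ c)

module _ (d : ℕ) .{{_ : NonZero d}} where

  -- cyclic paper index j (any natural, taken mod d, with j ≡ d ↦ colour d)
  col : ℕ → Fin d
  col j = (j + (d ∸ 1)) mod d

  X Y X' Y' : ℕ → V d
  X  j = x  (col j)
  Y  j = y  (col j)
  X' j = x' (col j)
  Y' j = y' (col j)

VSet : ℕ → Set
VSet d = V d → Bool

_⊆_ : ∀ {d} → VSet d → VSet d → Set
S ⊆ T = ∀ v → S v ≡ true → T v ≡ true

_≐_ : ∀ {d} → VSet d → VSet d → Set
S ≐ T = ∀ v → S v ≡ T v

module Construction (d : ℕ) .{{_ : NonZero d}} where

  Idx : ℕ → Set
  Idx i = 1 ≤ i × i ≤ d + d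

  -- facet of ∂P determined by a choice (true = x_c, false = y_c) per colour
  crossFacet : (Fin d → Bool) → VSet d
  crossFacet ch (x c)  = ch c
  crossFacet ch (y c)  = not (ch c)
  crossFacet ch (x' c) = false
  crossFacet ch (y' c) = false

  chooseσ : ℕ → Fin d → Bool
  chooseσ i c = if i ≤ᵇ d then pc c ≤ᵇ i else not (pc c ≤ᵇ (i ∸ d))

  sigma : ℕ → VSet d
  sigma i = crossFacet (chooseσ i)

  -- f together with its inverse, as one involution of V d:
  -- on unprimed vertices it is f, on primed vertices it is f⁻¹.
  fhat : V d → V d
  fhat (x c)  = if pc c ≡ᵇ d then Y' d 1 else X' d (pc c + 1)
  fhat (y c)  = if pc c ≡ᵇ d then X' d 1 else Y' d (pc c + 1)
  fhat (x' c) = if pc c ≡ᵇ 1 then Y d d else X d (pc c ∸ 1)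
  fhat (y' c) = if pc c ≡ᵇ 1 then X d d else Y d (pc c ∸ 1)

  -- image f(S) of a set S of unprimed vertices: v ∈ f(S) iff f⁻¹(v) ∈ S
  fimg : VSet d → VSet d
  fimg S v = S (fhat v)

  -- facets of Γ_i : per colour choose the vertex of σ_i (true) or of f(σ_i)
  ΓF : ℕ → (Fin d → Bool) → VSet d
  ΓF i b v = if b (color v) then sigma i v else fimg (sigma i) v

  E : ℕ → V d × V d
  E i =
    if (1 ≤ᵇ i) ∧ (i ≤ᵇ (d ∸ 2)) then (X' d (i + 1) , Y d (i + 2))
    else if i ≡ᵇ (d ∸ 1) then (X' d d , X d 1)
    else if i ≡ᵇ d then (Y' d 1 , X d 2)
    else if i ≤ᵇ (d + d ∸ 2) then (Y' d (i ∸ d + 1) , X d (i ∸ d + 2))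
    else if i ≡ᵇ (d + d ∸ 1) then (Y' d d , Y d 1)
    else (X' d 1 , Y d 2)

  prev : ℕ → ℕ
  prev i = if i ≡ᵇ 1 then d + d else i ∸ 1

  Contains : VSet d → V d × V d → Set
  Contains F (u , w) = F u ≡ true × F w ≡ true

  Kept : ℕ → (Fin d → Bool) → Set
  Kept i b = ¬ Contains (ΓF i b) (E (prev i)) × ¬ Contains (ΓF i b) (E i)

  InΔ₁ : VSet d → Set
  InΔ₁ F = ∃[ j ] (Idx j × F ⊆ sigma j)

  InfΔ₁ : VSet d → Set
  InfΔ₁ F = ∃[ j ] (Idx j × F ⊆ fimg (sigma j))

  IsSigma : (Fin d → Bool) → Set
  IsSigma ch = ∃[ j ] (Idx j × crossFacet ch ≐ sigma j)

  -- faces of Σ : subsets of a facet of Δ₂, of N, or of f(Δ₂)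
  IsFace : VSet d → Set
  IsFace S =
      (∃[ ch ] (¬ IsSigma ch × S ⊆ crossFacet ch))
    ⊎ (∃[ i ] ∃[ b ] (Idx i × Kept i b × ¬ InΔ₁ (ΓF i b) × ¬ InfΔ₁ (ΓF i b)
                      × S ⊆ ΓF i b))
    ⊎ (∃[ ch ] (¬ IsSigma ch × S ⊆ fimg (crossFacet ch)))

  -- simplicial automorphism: a permutation φ of the vertices with
  -- S ∈ Σ ⇔ φ(S) ∈ Σ, where φ(S) w = S (φ⁻¹ w)
  IsAut : V d ↔ V d → Set
  IsAut φ = ∀ (S : VSet d) →
    (IsFace S → IsFace (λ w → S (Inverse.from φ w))) ×
    (IsFace (λ w → S (Inverse.from φ w)) → IsFace S)

-- The group ℤ₂ × D_{2d}; D_{2d} has order 4d (symmetries of a 2d-gon).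
-- (z , a , e) encodes z ∈ ℤ₂ and r^a s^e with r of order 2d, s² = 1,
-- s r s = r⁻¹.

nz2 : ∀ d → .{{NonZero d}} → NonZero (d + d)
nz2 (suc n) = _

module Group (d : ℕ) .{{nz : NonZero d}} where

  G : Set
  G = Bool × Fin (d + d) × Bool

  addR : Fin (d + d) → Fin (d + d) → Fin (d + d)
  addR a b = _mod_ (toℕ a + toℕ b) (d + d) {{nz2 d}}

  negR : Fin (d + d) → Fin (d + d)
  negR b = _mod_ ((d + d) ∸ toℕ b) (d + d) {{nz2 d}}

  -- (r^a s^e)(r^b s^f) = r^(a + (-1)^e b) s^(e+f)
  _·_ : G → G → G
  (z₁ , a , e) · (z₂ , b , f) =
    (z₁ xor z₂ , addR a (if e then negR b else b) , e xor f)

module Submission where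

-- Put the 2d vertices x₁,…,x_d,y₁,…,y_d of ∂P on a cycle of positions
-- (Positions); every vertex of Σ is a position in the lower layer (x, y) or in the
-- upper layer (x', y') (Vertices). Then σ₁,…,σ_{2d} are the windows of d consecutive
-- positions, and f moves one step along the cycle while changing the layer. The
-- facets of Σ become (FacetModel): facets of ∂P that are not windows, in either
-- layer, and the facets Γ J b of the Γ_i which avoid the edges e_{i-1}, e_i and use
-- both layers. Rotating the cycle (turn), exchanging the layers (swap) and reflecting
-- the cycle while exchanging the layers (flip) pull facets back to facets; the key
-- case is swap on Γ J b, which lands in Γ_{J-1} or Γ_{J+1}.

open import Defs

open import Data.Nat using (ℕ; NonZero; zero; suc; _+_; _∸_; _≤ᵇ_; _≡ᵇ_; _≤_; _<_; z≤n; s≤s; s≤s⁻¹)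
open import Data.Nat.Properties
  using ( ≤⇒≤ᵇ; ≤ᵇ⇒≤; ≡⇒≡ᵇ; ≡ᵇ⇒≡; _≤?_; ≤-refl; ≤-reflexive; ≤-trans; <⇒≤; <⇒≢; <⇒≱; ≰⇒>; ≤∧≢⇒<
        ; <-asym; <-irrefl; n<1+n; m≤n⇒m≤1+n; 1+n≢n; 1+n≢0; suc-injective
        ; +-suc; +-comm; +-identityʳ; +-cancelˡ-≡; m≤m+n; m<m+n; +-monoʳ-≤; +-monoʳ-<
        ; +-∸-assoc; m+n∸m≡n; m+[n∸m]≡n; m∸n+n≡m; m∸n≤m; m<n+o⇒m∸n<o
        ; ∸-monoʳ-≤; ∸-monoʳ-<; ∸-monoˡ-≤; ∸-cancelʳ-≤ )
open import Data.Fin using (Fin; zero; suc; toℕ; fromℕ; fromℕ<; inject₁; opposite)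
open import Data.Fin.Properties
  using (toℕ-injective; toℕ<n; toℕ-fromℕ; toℕ-fromℕ<; toℕ-inject₁; opposite-prop; opposite-involutive; ¬∀⟶∃¬)
open import Data.Nat.DivMod using (_%_; [m+n]%n≡m%n; m<n⇒m%n≡m; n%n≡0; %-distribˡ-+; m%n%n≡m%n)
open import Data.Bool using (Bool; true; false; not; _xor_; _∧_; if_then_else_)
open import Data.Product using (Σ-syntax; _×_; _,_; proj₁; proj₂)
open import Data.Sum using (inj₁; inj₂)
open import Relation.Nullary using (¬_; yes; no)
open import Data.Bool.Properties
  using ( T-≡; ⇔→≡; ¬-not; _≟_; if-not; if-cong₂; ∧-zeroʳ; not-involutive; not-distribˡ-xor; not-distribʳ-xor
        ; xor-assoc; xor-comm; xor-same; xor-identityʳ; xor-∧-commutativeRing )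
open import Data.Empty using (⊥-elim)
open import Relation.Binary.PropositionalEquality
  using (_≡_; _≢_; refl; sym; trans; cong; cong₂; subst; subst₂; module ≡-Reasoning)
open import Function.Bundles using (Equivalence; mk⇔; _⇔_; _↔_; Inverse; mk↔ₛ′)
open import Function.Base using (_∘_; case_of_)
open import Algebra.Bundles using (CommutativeRing)
open import Algebra.Properties.CommutativeSemigroup
  (CommutativeRing.+-commutativeSemigroup xor-∧-commutativeRing) using (interchange)

≤ᵇ-true : ∀ {a b} → a ≤ b → (a ≤ᵇ b) ≡ true
≤ᵇ-true a≤b = Equivalence.to T-≡ (≤⇒≤ᵇ a≤b)

≤ᵇ-false : ∀ {a b} → b < a → (a ≤ᵇ b) ≡ false
≤ᵇ-false {a} {b} b<a = ¬-not (λ a≤ᵇb → <⇒≱ b<a (≤ᵇ⇒≤ a b (Equivalence.from T-≡ a≤ᵇb)))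

≡ᵇ-true : ∀ {a b} → a ≡ b → (a ≡ᵇ b) ≡ true
≡ᵇ-true {a} {b} a≡b = Equivalence.to T-≡ (≡⇒≡ᵇ a b a≡b)

≡ᵇ-false : ∀ {a b} → a ≢ b → (a ≡ᵇ b) ≡ false
≡ᵇ-false {a} {b} a≢b = ¬-not (λ a≡ᵇb → a≢b (≡ᵇ⇒≡ a b (Equivalence.from T-≡ a≡ᵇb)))

if-true : ∀ {A : Set} {b} {t e : A} → b ≡ true → (if b then t else e) ≡ t
if-true refl = refl

if-false : ∀ {A : Set} {b} {t e : A} → b ≡ false → (if b then t else e) ≡ e
if-false refl = refl

≤ᵇ-≡ : ∀ {a b c e} → (a ≤ b → c ≤ e) → (c ≤ e → a ≤ b) → (a ≤ᵇ b) ≡ (c ≤ᵇ e)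
≤ᵇ-≡ {a} {b} {c} {e} to from = ⇔→≡ (mk⇔
  (λ p → ≤ᵇ-true (to (≤ᵇ⇒≤ a b (Equivalence.from T-≡ p))))
  (λ q → ≤ᵇ-true (from (≤ᵇ⇒≤ c e (Equivalence.from T-≡ q)))))

suc-≤ᵇ : ∀ a b → (suc a ≤ᵇ suc b) ≡ (a ≤ᵇ b)
suc-≤ᵇ a b = ≤ᵇ-≡ {suc a} {suc b} {a} {b} s≤s⁻¹ s≤s

≤ᵇ-suc-≢ : ∀ {a b} → a ≢ suc b → (a ≤ᵇ suc b) ≡ (a ≤ᵇ b)
≤ᵇ-suc-≢ {a} {b} a≢sb = ≤ᵇ-≡ {a} {suc b} {a} {b}
  (λ a≤sb → s≤s⁻¹ (≤∧≢⇒< a≤sb a≢sb)) (λ a≤b → m≤n⇒m≤1+n a≤b)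

<ᵇ-not : ∀ a b → (suc a ≤ᵇ b) ≡ not (b ≤ᵇ a)
<ᵇ-not a b with b ≤? a
... | yes b≤a = trans (≤ᵇ-false (s≤s b≤a)) (cong not (sym (≤ᵇ-true b≤a)))
... | no b≰a = trans (≤ᵇ-true (≰⇒> b≰a)) (cong not (sym (≤ᵇ-false (≰⇒> b≰a))))

∸-≤ᵇ-flip : ∀ n a b → b ≤ n → (n ∸ a ≤ᵇ n ∸ b) ≡ (b ≤ᵇ a)
∸-≤ᵇ-flip n a b b≤n = ≤ᵇ-≡ (∸-cancelʳ-≤ b≤n) (∸-monoʳ-≤ n)

xor-interchange : ∀ a b c e → (a xor b) xor (c xor e) ≡ (a xor c) xor (b xor e)
xor-interchange = interchange

xor-cancelˡ : ∀ a b → a xor (a xor b) ≡ b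
xor-cancelˡ a b = trans (sym (xor-assoc a a b)) (cong (_xor b) (xor-same a))

xor-cancelʳ : ∀ a b → (a xor b) xor b ≡ a
xor-cancelʳ a b = trans (xor-assoc a b b) (trans (cong (a xor_) (xor-same b)) (xor-identityʳ a))

xor-cancel-outer : ∀ a b → (a xor b) xor a ≡ b
xor-cancel-outer a b = trans (cong (_xor a) (xor-comm a b)) (xor-cancelʳ b a)

xor-regroup : ∀ a b c e → (a xor (b xor c)) xor e ≡ (a xor b) xor (c xor e)
xor-regroup a b c e = trans (xor-assoc a (b xor c) e) (trans (cong (a xor_) (xor-assoc b c e)) (sym (xor-assoc a b (c xor e))))

not-flip : ∀ {a t} → not a ≡ t → a ≡ not t
not-flip {a} e = trans (sym (not-involutive a)) (cong not e)

-- Every element of Fin (suc n) is either the last one or comes from Fin n; this view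
-- is how we compute the cyclic successor of a colour.
data Place (n : ℕ) : Fin (suc n) → Set where
  last  : Place n (fromℕ n)
  inner : (c : Fin n) → Place n (inject₁ c)

placeSuc : ∀ {n} {c : Fin (suc n)} → Place n c → Place (suc n) (suc c)
placeSuc last      = last
placeSuc (inner c) = inner (suc c)

place : ∀ {n} (c : Fin (suc n)) → Place n c
place {zero}  zero    = last
place {suc n} zero    = inner zero
place {suc n} (suc c) = placeSuc (place c)

place-last : ∀ n → place (fromℕ n) ≡ last
place-last zero    = refl
place-last (suc n) = cong placeSuc (place-last n)

place-inner : ∀ {n} (c : Fin n) → place (inject₁ c) ≡ inner c
place-inner {suc n} zero    = refl
place-inner {suc n} (suc c) = cong placeSuc (place-inner c)

module Cycle (n : ℕ) where

  Colour : Set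
  Colour = Fin (suc n)

  nextAt : ∀ {c} → Place n c → Colour
  nextAt last      = zero
  nextAt (inner c) = suc c

  isLastAt : ∀ {c} → Place n c → Bool
  isLastAt last      = true
  isLastAt (inner c) = false

  next : Colour → Colour
  next c = nextAt (place c)

  prev : Colour → Colour
  prev zero    = fromℕ n
  prev (suc c) = inject₁ c

  isLast isFirst : Colour → Bool
  isLast c = isLastAt (place c)
  isFirst zero    = true
  isFirst (suc c) = false

  _≤ᶜ_ : Colour → Colour → Bool
  c ≤ᶜ k = toℕ c ≤ᵇ toℕ k

  next-last : next (fromℕ n) ≡ zero
  next-last = cong nextAt (place-last n)

  next-inner : ∀ c → next (inject₁ c) ≡ suc c
  next-inner c = cong nextAt (place-inner c)

  isLast-last : isLast (fromℕ n) ≡ true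
  isLast-last = cong isLastAt (place-last n)

  isLast-inner : ∀ c → isLast (inject₁ c) ≡ false
  isLast-inner c = cong isLastAt (place-inner c)

  prev-next : ∀ c → prev (next c) ≡ c
  prev-next c with place c
  ... | last    = refl
  ... | inner _ = refl

  next-prev : ∀ c → next (prev c) ≡ c
  next-prev zero    = next-last
  next-prev (suc c) = next-inner c

  isFirst-next : ∀ c → isFirst (next c) ≡ isLast c
  isFirst-next c with place c
  ... | last    = refl
  ... | inner _ = refl

  isLast-prev : ∀ c → isLast (prev c) ≡ isFirst c
  isLast-prev zero    = isLast-last
  isLast-prev (suc c) = isLast-inner c

  isLast-toℕ : ∀ c → isLast c ≡ (toℕ c ≡ᵇ n)
  isLast-toℕ c with place c
  ... | last    = sym (≡ᵇ-true (toℕ-fromℕ n))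
  ... | inner c = sym (≡ᵇ-false (λ e → <⇒≢ (toℕ<n c) (trans (sym (toℕ-inject₁ c)) e)))

  isLast-zero : 1 ≤ n → isLast zero ≡ false
  isLast-zero 1≤n = trans (isLast-toℕ zero) (≡ᵇ-false (<⇒≢ 1≤n))

  toℕ-isLast : ∀ c → isLast c ≡ true → toℕ c ≡ n
  toℕ-isLast c with place c
  ... | last    = λ _ → toℕ-fromℕ n
  ... | inner _ = λ ()

  next-isLast : ∀ c → isLast c ≡ true → next c ≡ zero
  next-isLast c with place c
  ... | last    = λ _ → refl
  ... | inner _ = λ ()

  toℕ-next : ∀ c → isLast c ≡ false → toℕ (next c) ≡ suc (toℕ c)
  toℕ-next c with place c
  ... | last    = λ ()
  ... | inner c = λ _ → cong suc (sym (toℕ-inject₁ c))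

  opposite-last : opposite (fromℕ n) ≡ zero
  opposite-last = opposite-involutive zero

  opposite-inner : ∀ c → opposite (inject₁ c) ≡ suc (opposite c)
  opposite-inner c = toℕ-injective (begin
    toℕ (opposite (inject₁ c))  ≡⟨ opposite-prop (inject₁ c) ⟩
    n ∸ toℕ (inject₁ c)         ≡⟨ cong (n ∸_) (toℕ-inject₁ c) ⟩
    n ∸ toℕ c                   ≡⟨ +-∸-assoc 1 (toℕ<n c) ⟩
    suc (n ∸ suc (toℕ c))       ≡⟨ cong suc (sym (opposite-prop c)) ⟩
    toℕ (suc (opposite c))      ∎)
    where open ≡-Reasoning

  isLast-opposite : ∀ c → isLast (opposite c) ≡ isFirst c
  isLast-opposite zero    = isLast-last
  isLast-opposite (suc c) = isLast-inner (opposite c)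

  next-opposite : ∀ c → next (opposite c) ≡ opposite (prev c)
  next-opposite zero    = trans next-last (sym opposite-last)
  next-opposite (suc c) = trans (next-inner (opposite c)) (sym (opposite-inner c))

  next-opposite-next : ∀ c → next (opposite (next c)) ≡ opposite c
  next-opposite-next c = trans (next-opposite (next c)) (cong opposite (prev-next c))

  ≤ᶜ-last : ∀ c → (c ≤ᶜ fromℕ n) ≡ true
  ≤ᶜ-last c = ≤ᵇ-true (subst (toℕ c ≤_) (sym (toℕ-fromℕ n)) (s≤s⁻¹ (toℕ<n c)))

  last-≤ᶜ-inner : ∀ k → (fromℕ n ≤ᶜ inject₁ k) ≡ false
  last-≤ᶜ-inner k = ≤ᵇ-false (subst₂ _<_ (sym (toℕ-inject₁ k)) (sym (toℕ-fromℕ n)) (toℕ<n k))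

  ≤ᶜ-inner : ∀ c k → (inject₁ c ≤ᶜ inject₁ k) ≡ (toℕ c ≤ᵇ toℕ k)
  ≤ᶜ-inner c k = cong₂ _≤ᵇ_ (toℕ-inject₁ c) (toℕ-inject₁ k)

  -- Passing to successors preserves the order, except across the wrap-around.
  ≤ᶜ-next : ∀ c k → (isLast c xor isLast k) xor (next c ≤ᶜ next k) ≡ (c ≤ᶜ k)
  ≤ᶜ-next c k with place c | place k
  ... | last    | last    = sym (≤ᶜ-last (fromℕ n))
  ... | last    | inner k = sym (last-≤ᶜ-inner k)
  ... | inner c | last    = sym (≤ᶜ-last (inject₁ c))
  ... | inner c | inner k = trans (suc-≤ᵇ (toℕ c) (toℕ k)) (sym (≤ᶜ-inner c k))

  ≤ᶜ-opposite : ∀ c k → isLast k xor (opposite c ≤ᶜ opposite (next k)) ≡ not (c ≤ᶜ k)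
  ≤ᶜ-opposite c k with place k
  ... | last    = trans (cong not (≤ᶜ-last (opposite c))) (cong not (sym (≤ᶜ-last c)))
  ... | inner k = begin
    toℕ (opposite c) ≤ᵇ toℕ (opposite (suc k)) ≡⟨ cong₂ _≤ᵇ_ (opposite-prop c) (opposite-prop (suc k)) ⟩
    n ∸ toℕ c ≤ᵇ n ∸ suc (toℕ k)               ≡⟨ ∸-≤ᵇ-flip n (toℕ c) (suc (toℕ k)) (toℕ<n k) ⟩
    suc (toℕ k) ≤ᵇ toℕ c                       ≡⟨ <ᵇ-not (toℕ k) (toℕ c) ⟩
    not (toℕ c ≤ᵇ toℕ k)                       ≡⟨ cong (λ t → not (toℕ c ≤ᵇ t)) (sym (toℕ-inject₁ k)) ⟩
    not (c ≤ᶜ inject₁ k)                       ∎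
    where open ≡-Reasoning

  ≤ᶜ-step : ∀ c k → c ≢ next k → isLast k xor (c ≤ᶜ next k) ≡ (c ≤ᶜ k)
  ≤ᶜ-step c k c≢nk with place k
  ≤ᶜ-step zero    k c≢nk | last    = ⊥-elim (c≢nk refl)
  ≤ᶜ-step (suc c) k c≢nk | last    = sym (≤ᶜ-last (suc c))
  ≤ᶜ-step c       _ c≢nk | inner k =
    trans (≤ᵇ-suc-≢ (λ e → c≢nk (toℕ-injective e)))
          (cong (toℕ c ≤ᵇ_) (sym (toℕ-inject₁ k)))

  next-≤ᶜ : ∀ k → (next k ≤ᶜ k) ≡ isLast k
  next-≤ᶜ k with place k
  ... | last    = refl
  ... | inner k = ≤ᵇ-false (s≤s (≤-reflexive (toℕ-inject₁ k)))

  ≢-next : 1 ≤ n → ∀ k → k ≢ next k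
  ≢-next 1≤n k with place k
  ... | last    = λ e → <⇒≢ 1≤n (sym (trans (sym (toℕ-fromℕ n)) (cong toℕ e)))
  ... | inner k = λ e → 1+n≢n (sym (trans (sym (toℕ-inject₁ k)) (cong toℕ e)))

  next-next-≤ᶜ : 1 ≤ n → ∀ k → (next (next k) ≤ᶜ k) ≡ isLast k xor isLast (next k)
  next-next-≤ᶜ 1≤n k = begin
    next (next k) ≤ᶜ k                             ≡⟨ sym (≤ᶜ-step _ k (≢-next 1≤n (next k) ∘ sym)) ⟩
    isLast k xor (next (next k) ≤ᶜ next k)         ≡⟨ cong (isLast k xor_) (next-≤ᶜ (next k)) ⟩
    isLast k xor isLast (next k)                   ∎
    where open ≡-Reasoning

-- The cycle of the 2d vertices of ∂P and its windows.
module Positions (n : ℕ) where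

  open Cycle n public

  -- The 2d vertices x₁,…,x_d,y₁,…,y_d of ∂P in cyclic order:
  -- (false , c) stands for x_c and (true , c) for y_c.
  Pos : Set
  Pos = Bool × Colour

  rot rot⁻¹ : Pos → Pos
  rot   (h , c) = (h xor isLast c , next c)
  rot⁻¹ (h , c) = (h xor isFirst c , prev c)

  antipode reflect : Pos → Pos
  antipode (h , c) = (not h , c)
  reflect  (h , c) = (not h , opposite c)

  -- window J p : p lies among the d consecutive positions ending at J.
  -- These windows are exactly the facets σ₁,…,σ_{2d} of Δ₁.
  window : Pos → Pos → Bool
  window (h , k) (h' , c) = (h' xor h) xor (c ≤ᶜ k)

  -- reflect maps the window ending at J onto the window ending at mirror J.
  mirror : Pos → Pos
  mirror (h , k) = (h xor isLast k , opposite (next k))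

  rot⁻¹-rot : ∀ p → rot⁻¹ (rot p) ≡ p
  rot⁻¹-rot (h , c) = cong₂ _,_
    (trans (cong ((h xor isLast c) xor_) (isFirst-next c)) (xor-cancelʳ h (isLast c)))
    (prev-next c)

  rot-rot⁻¹ : ∀ p → rot (rot⁻¹ p) ≡ p
  rot-rot⁻¹ (h , c) = cong₂ _,_
    (trans (cong ((h xor isFirst c) xor_) (isLast-prev c)) (xor-cancelʳ h (isFirst c)))
    (next-prev c)

  rot-antipode : ∀ p → rot (antipode p) ≡ antipode (rot p)
  rot-antipode (h , c) = cong (_, next c) (sym (not-distribˡ-xor h (isLast c)))

  rot⁻¹-antipode : ∀ p → rot⁻¹ (antipode p) ≡ antipode (rot⁻¹ p)
  rot⁻¹-antipode (h , c) = cong (_, prev c) (sym (not-distribˡ-xor h (isFirst c)))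

  reflect-antipode : ∀ p → reflect (antipode p) ≡ antipode (reflect p)
  reflect-antipode (h , c) = refl

  reflect-reflect : ∀ p → reflect (reflect p) ≡ p
  reflect-reflect (h , c) = cong₂ _,_ (not-involutive h) (opposite-involutive c)

  rot-reflect-rot : ∀ p → rot (reflect (rot p)) ≡ reflect p
  rot-reflect-rot (h , c) = cong₂ _,_
    (begin
      not (h xor isLast c) xor isLast (opposite (next c)) ≡⟨ cong (not (h xor isLast c) xor_) (trans (isLast-opposite (next c)) (isFirst-next c)) ⟩
      not (h xor isLast c) xor isLast c                   ≡⟨ cong (_xor isLast c) (not-distribˡ-xor h (isLast c)) ⟩
      (not h xor isLast c) xor isLast c                   ≡⟨ xor-cancelʳ (not h) (isLast c) ⟩
      not h                                               ∎)
    (next-opposite-next c)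
    where open ≡-Reasoning

  rot-mirror-rot : ∀ J → rot (mirror (rot J)) ≡ mirror J
  rot-mirror-rot (h , k) = cong₂ _,_
    (begin
      ((h xor isLast k) xor isLast (next k)) xor isLast (opposite (next (next k)))
        ≡⟨ cong (((h xor isLast k) xor isLast (next k)) xor_) (trans (isLast-opposite (next (next k))) (isFirst-next (next k))) ⟩
      ((h xor isLast k) xor isLast (next k)) xor isLast (next k)
        ≡⟨ xor-cancelʳ (h xor isLast k) (isLast (next k)) ⟩
      h xor isLast k ∎)
    (next-opposite-next (next k))
    where open ≡-Reasoning

  window-rot : ∀ J p → window (rot J) (rot p) ≡ window J p
  window-rot (h , k) (h' , c) = begin
    ((h' xor isLast c) xor (h xor isLast k)) xor (next c ≤ᶜ next k)
      ≡⟨ cong (_xor (next c ≤ᶜ next k)) (xor-interchange h' (isLast c) h (isLast k)) ⟩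
    ((h' xor h) xor (isLast c xor isLast k)) xor (next c ≤ᶜ next k)
      ≡⟨ xor-assoc (h' xor h) _ _ ⟩
    (h' xor h) xor ((isLast c xor isLast k) xor (next c ≤ᶜ next k))
      ≡⟨ cong ((h' xor h) xor_) (≤ᶜ-next c k) ⟩
    (h' xor h) xor (c ≤ᶜ k) ∎
    where open ≡-Reasoning

  window-rot-left : ∀ J p → window J (rot p) ≡ window (rot⁻¹ J) p
  window-rot-left J p = trans (cong (λ K → window K (rot p)) (sym (rot-rot⁻¹ J))) (window-rot (rot⁻¹ J) p)

  window-rot⁻¹ : ∀ J p → window J (rot⁻¹ p) ≡ window (rot J) p
  window-rot⁻¹ J p = trans (sym (window-rot J (rot⁻¹ p))) (cong (window (rot J)) (rot-rot⁻¹ p))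

  window-reflect : ∀ J p → window (mirror J) (reflect p) ≡ window J p
  window-reflect (h , k) (h' , c) = begin
    (not h' xor (h xor isLast k)) xor O
      ≡⟨ cong (_xor O) (sym (not-distribˡ-xor h' (h xor isLast k))) ⟩
    not (h' xor (h xor isLast k)) xor O
      ≡⟨ sym (not-distribˡ-xor (h' xor (h xor isLast k)) O) ⟩
    not ((h' xor (h xor isLast k)) xor O)
      ≡⟨ cong not (xor-regroup h' h (isLast k) O) ⟩
    not ((h' xor h) xor (isLast k xor O))
      ≡⟨ cong (λ t → not ((h' xor h) xor t)) (≤ᶜ-opposite c k) ⟩
    not ((h' xor h) xor not (c ≤ᶜ k))
      ≡⟨ cong not (sym (not-distribʳ-xor (h' xor h) (c ≤ᶜ k))) ⟩
    not (not ((h' xor h) xor (c ≤ᶜ k)))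
      ≡⟨ not-involutive _ ⟩
    (h' xor h) xor (c ≤ᶜ k) ∎
    where
    open ≡-Reasoning
    O : Bool
    O = opposite c ≤ᶜ opposite (next k)

  window-reflect⁻¹ : ∀ J p → window J (reflect p) ≡ window (mirror J) p
  window-reflect⁻¹ J p = trans (sym (window-reflect J (reflect p))) (cong (window (mirror J)) (reflect-reflect p))

  window-antipode : ∀ J p → window J (antipode p) ≡ not (window J p)
  window-antipode (h , k) (h' , c) =
    trans (cong (_xor (c ≤ᶜ k)) (sym (not-distribˡ-xor h' h))) (sym (not-distribˡ-xor (h' xor h) (c ≤ᶜ k)))

  window-step : ∀ J h' c → c ≢ next (proj₂ J) → window (rot J) (h' , c) ≡ window J (h' , c)
  window-step (h , k) h' c c≢nk =
    trans (xor-regroup h' h (isLast k) (c ≤ᶜ next k)) (cong ((h' xor h) xor_) (≤ᶜ-step c k c≢nk))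

  window-step⁻¹ : ∀ J h' c → c ≢ proj₂ J → window (rot⁻¹ J) (h' , c) ≡ window J (h' , c)
  window-step⁻¹ J h' c c≢k =
    trans (sym (window-step (rot⁻¹ J) h' c (subst (c ≢_) (sym (next-prev (proj₂ J))) c≢k)))
          (cong (λ K → window K (h' , c)) (rot-rot⁻¹ J))

  window-self : ∀ J → window J J ≡ true
  window-self (h , k) = trans (cong (_xor (k ≤ᶜ k)) (xor-same h)) (≤ᵇ-true (≤-refl {toℕ k}))

  window-rot-self : 1 ≤ n → ∀ J → window (rot J) J ≡ true
  window-rot-self 1≤n (h , k) = begin
    (h xor (h xor isLast k)) xor (k ≤ᶜ next k) ≡⟨ cong (_xor (k ≤ᶜ next k)) (xor-cancelˡ h (isLast k)) ⟩
    isLast k xor (k ≤ᶜ next k)                 ≡⟨ ≤ᶜ-step k k (≢-next 1≤n k) ⟩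
    k ≤ᶜ k                                     ≡⟨ ≤ᵇ-true (≤-refl {toℕ k}) ⟩
    true                                       ∎
    where open ≡-Reasoning

  window-antipode-rot : ∀ J → window J (antipode (rot J)) ≡ true
  window-antipode-rot (h , k) = begin
    window (h , k) (antipode (rot (h , k)))       ≡⟨ window-antipode (h , k) (rot (h , k)) ⟩
    not (((h xor isLast k) xor h) xor (next k ≤ᶜ k)) ≡⟨ cong₂ (λ a b → not (a xor b)) (xor-cancel-outer h (isLast k)) (next-≤ᶜ k) ⟩
    not (isLast k xor isLast k)                   ≡⟨ cong not (xor-same (isLast k)) ⟩
    true                                          ∎
    where open ≡-Reasoning

  window-antipode-rot² : 1 ≤ n → ∀ J → window J (antipode (rot (rot J))) ≡ true
  window-antipode-rot² 1≤n (h , k) = begin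
    window (h , k) (antipode (rot (rot (h , k))))
      ≡⟨ window-antipode (h , k) (rot (rot (h , k))) ⟩
    not ((((h xor isLast k) xor isLast (next k)) xor h) xor (next (next k) ≤ᶜ k))
      ≡⟨ cong₂ (λ a b → not (a xor b)) shift (next-next-≤ᶜ 1≤n k) ⟩
    not ((isLast k xor isLast (next k)) xor (isLast k xor isLast (next k)))
      ≡⟨ cong not (xor-same (isLast k xor isLast (next k))) ⟩
    true ∎
    where
    open ≡-Reasoning
    shift : ((h xor isLast k) xor isLast (next k)) xor h ≡ isLast k xor isLast (next k)
    shift = trans (cong (_xor h) (xor-assoc h (isLast k) (isLast (next k)))) (xor-cancel-outer h _)

  -- For at least two colours, two steps along the cycle never return to the start:
  -- returning would need the colour to wrap around without changing the layer.
  rot²-≢ : 1 ≤ n → ∀ q → rot (rot q) ≢ q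
  rot²-≢ 1≤n (h , k) back = case trans (sym same-parity) (trans (sym (next-next-≤ᶜ 1≤n k)) returns) of λ ()
    where
    returns : (next (next k) ≤ᶜ k) ≡ true
    returns = trans (cong (_≤ᶜ k) (cong proj₂ back)) (≤ᵇ-true (≤-refl {toℕ k}))
    same-parity : isLast k xor isLast (next k) ≡ false
    same-parity = begin
      isLast k xor isLast (next k)                  ≡⟨ sym (xor-cancelˡ h _) ⟩
      h xor (h xor (isLast k xor isLast (next k)))  ≡⟨ cong (h xor_) (sym (xor-assoc h (isLast k) (isLast (next k)))) ⟩
      h xor ((h xor isLast k) xor isLast (next k))  ≡⟨ cong (h xor_) (cong proj₁ back) ⟩
      h xor h                                       ≡⟨ xor-same h ⟩
      false                                         ∎
      where open ≡-Reasoning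

-- Rotations and reflections of the cycle: the dihedral group of order 4d.
module Dihedral (n : ℕ) where

  open Positions n public

  N : ℕ
  N = suc n + suc n

  rotate : ℕ → Pos → Pos
  rotate zero    p = p
  rotate (suc k) p = rot (rotate k p)

  reflectIf : Bool → Pos → Pos
  reflectIf false p = p
  reflectIf true  p = reflect p

  rotate-+ : ∀ a b p → rotate (a + b) p ≡ rotate a (rotate b p)
  rotate-+ zero    b p = refl
  rotate-+ (suc a) b p = cong rot (rotate-+ a b p)

  rotate-rot : ∀ a p → rotate a (rot p) ≡ rot (rotate a p)
  rotate-rot zero    p = refl
  rotate-rot (suc a) p = cong rot (rotate-rot a p)

  rotate-rot⁻¹ : ∀ a p → rotate a (rot⁻¹ p) ≡ rot⁻¹ (rotate a p)
  rotate-rot⁻¹ a p = begin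
    rotate a (rot⁻¹ p)             ≡⟨ sym (rot⁻¹-rot _) ⟩
    rot⁻¹ (rot (rotate a (rot⁻¹ p))) ≡⟨ cong rot⁻¹ (sym (rotate-rot a (rot⁻¹ p))) ⟩
    rot⁻¹ (rotate a (rot (rot⁻¹ p))) ≡⟨ cong (λ q → rot⁻¹ (rotate a q)) (rot-rot⁻¹ p) ⟩
    rot⁻¹ (rotate a p)             ∎
    where open ≡-Reasoning

  reflectIf-involutive : ∀ e p → reflectIf e (reflectIf e p) ≡ p
  reflectIf-involutive false p = refl
  reflectIf-involutive true  p = reflect-reflect p

  reflect-reflectIf : ∀ e p → reflect (reflectIf e p) ≡ reflectIf (not e) p
  reflect-reflectIf false p = refl
  reflect-reflectIf true  p = reflect-reflect p

  reflect-rot : ∀ p → reflect (rot p) ≡ rot⁻¹ (reflect p)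
  reflect-rot p = trans (sym (rot⁻¹-rot _)) (cong rot⁻¹ (rot-reflect-rot p))

  posIndex : Pos → ℕ
  posIndex (false , c) = toℕ c
  posIndex (true  , c) = suc n + toℕ c

  posIndex<N : ∀ p → posIndex p < N
  posIndex<N (false , c) = ≤-trans (toℕ<n c) (m≤m+n (suc n) (suc n))
  posIndex<N (true  , c) = +-monoʳ-< (suc n) (toℕ<n c)

  posIndex-injective : ∀ p q → posIndex p ≡ posIndex q → p ≡ q
  posIndex-injective (false , c) (false , c') e = cong (false ,_) (toℕ-injective e)
  posIndex-injective (true  , c) (true  , c') e = cong (true ,_) (toℕ-injective (+-cancelˡ-≡ (suc n) _ _ e))
  posIndex-injective (false , c) (true  , c') e = ⊥-elim (<⇒≢ (≤-trans (toℕ<n c) (m≤m+n (suc n) (toℕ c'))) e)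
  posIndex-injective (true  , c) (false , c') e = ⊥-elim (<⇒≢ (≤-trans (toℕ<n c') (m≤m+n (suc n) (toℕ c))) (sym e))

  posIndex-rot : ∀ p → posIndex (rot p) ≡ suc (posIndex p) % N
  posIndex-rot (h , c) with place c
  posIndex-rot (false , _) | last    =
    trans (+-identityʳ (suc n)) (sym (trans (cong (λ t → suc t % N) (toℕ-fromℕ n)) (m<n⇒m%n≡m (m<m+n (suc n) (s≤s z≤n)))))
  posIndex-rot (true  , _) | last    =
    sym (trans (cong (λ t → suc (suc n + t) % N) (toℕ-fromℕ n)) (trans (cong (_% N) (sym (+-suc (suc n) n))) (n%n≡0 N)))
  posIndex-rot (false , _) | inner c =
    sym (trans (cong (λ t → suc t % N) (toℕ-inject₁ c)) (m<n⇒m%n≡m (posIndex<N (false , suc c))))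
  posIndex-rot (true  , _) | inner c =
    sym (trans (cong (λ t → suc (suc n + t) % N) (toℕ-inject₁ c))
               (trans (cong (_% N) (sym (+-suc (suc n) (toℕ c)))) (m<n⇒m%n≡m (posIndex<N (true , suc c)))))

  %-absorbʳ : ∀ i k → (i + k % N) % N ≡ (i + k) % N
  %-absorbʳ i k = begin
    (i + k % N) % N           ≡⟨ %-distribˡ-+ i (k % N) N ⟩
    (i % N + k % N % N) % N   ≡⟨ cong (λ t → (i % N + t) % N) (m%n%n≡m%n k N) ⟩
    (i % N + k % N) % N       ≡⟨ sym (%-distribˡ-+ i k N) ⟩
    (i + k) % N               ∎
    where open ≡-Reasoning

  posIndex-rotate : ∀ k p → posIndex (rotate k p) ≡ (k + posIndex p) % N
  posIndex-rotate zero    p = sym (m<n⇒m%n≡m (posIndex<N p))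
  posIndex-rotate (suc k) p =
    trans (posIndex-rot (rotate k p)) (trans (cong (λ t → suc t % N) (posIndex-rotate k p)) (%-absorbʳ 1 (k + posIndex p)))

  rotate-% : ∀ k p → rotate (k % N) p ≡ rotate k p
  rotate-% k p = posIndex-injective _ _ (begin
    posIndex (rotate (k % N) p) ≡⟨ posIndex-rotate (k % N) p ⟩
    (k % N + posIndex p) % N    ≡⟨ cong (_% N) (+-comm (k % N) (posIndex p)) ⟩
    (posIndex p + k % N) % N    ≡⟨ %-absorbʳ (posIndex p) k ⟩
    (posIndex p + k) % N        ≡⟨ cong (_% N) (+-comm (posIndex p) k) ⟩
    (k + posIndex p) % N        ≡⟨ sym (posIndex-rotate k p) ⟩
    posIndex (rotate k p)       ∎)
    where open ≡-Reasoning

  rotate-N : ∀ p → rotate N p ≡ p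
  rotate-N p = trans (sym (rotate-% N p)) (cong (λ k → rotate k p) (n%n≡0 N))

  rotate-reflect-rotate : ∀ b p → rotate b (reflect (rotate b p)) ≡ reflect p
  rotate-reflect-rotate zero    p = refl
  rotate-reflect-rotate (suc b) p = begin
    rotate (suc b) (reflect (rot (rotate b p))) ≡⟨ cong (rotate (suc b)) (reflect-rot (rotate b p)) ⟩
    rotate (suc b) (rot⁻¹ (reflect (rotate b p))) ≡⟨ cong rot (rotate-rot⁻¹ b _) ⟩
    rot (rot⁻¹ (rotate b (reflect (rotate b p)))) ≡⟨ rot-rot⁻¹ _ ⟩
    rotate b (reflect (rotate b p))             ≡⟨ rotate-reflect-rotate b p ⟩
    reflect p                                   ∎
    where open ≡-Reasoning

  reflect-rotate : ∀ b p → b ≤ N → reflect (rotate b p) ≡ rotate (N ∸ b) (reflect p)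
  reflect-rotate b p b≤N = begin
    reflect (rotate b p)                            ≡⟨ sym (rotate-N _) ⟩
    rotate N (reflect (rotate b p))                 ≡⟨ cong (λ k → rotate k (reflect (rotate b p))) (sym (m∸n+n≡m b≤N)) ⟩
    rotate (N ∸ b + b) (reflect (rotate b p))       ≡⟨ rotate-+ (N ∸ b) b _ ⟩
    rotate (N ∸ b) (rotate b (reflect (rotate b p))) ≡⟨ cong (rotate (N ∸ b)) (rotate-reflect-rotate b p) ⟩
    rotate (N ∸ b) (reflect p)                      ∎
    where open ≡-Reasoning

  dihedral : Fin N → Bool → Pos → Pos
  dihedral a e p = rotate (toℕ a) (reflectIf e p)

  dihedral⁻¹ : Fin N → Bool → Pos → Pos
  dihedral⁻¹ a e p = reflectIf e (rotate (N ∸ toℕ a) p)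

  dihedral-dihedral⁻¹ : ∀ a e p → dihedral a e (dihedral⁻¹ a e p) ≡ p
  dihedral-dihedral⁻¹ a e p = begin
    rotate (toℕ a) (reflectIf e (reflectIf e (rotate (N ∸ toℕ a) p))) ≡⟨ cong (rotate (toℕ a)) (reflectIf-involutive e _) ⟩
    rotate (toℕ a) (rotate (N ∸ toℕ a) p)                             ≡⟨ sym (rotate-+ (toℕ a) (N ∸ toℕ a) p) ⟩
    rotate (toℕ a + (N ∸ toℕ a)) p                                    ≡⟨ cong (λ k → rotate k p) (m+[n∸m]≡n (<⇒≤ (toℕ<n a))) ⟩
    rotate N p                                                        ≡⟨ rotate-N p ⟩
    p                                                                 ∎
    where open ≡-Reasoning

  dihedral⁻¹-dihedral : ∀ a e p → dihedral⁻¹ a e (dihedral a e p) ≡ p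
  dihedral⁻¹-dihedral a e p = begin
    reflectIf e (rotate (N ∸ toℕ a) (rotate (toℕ a) (reflectIf e p))) ≡⟨ cong (reflectIf e) (sym (rotate-+ (N ∸ toℕ a) (toℕ a) _)) ⟩
    reflectIf e (rotate (N ∸ toℕ a + toℕ a) (reflectIf e p))          ≡⟨ cong (λ k → reflectIf e (rotate k (reflectIf e p))) (m∸n+n≡m (<⇒≤ (toℕ<n a))) ⟩
    reflectIf e (rotate N (reflectIf e p))                            ≡⟨ cong (reflectIf e) (rotate-N _) ⟩
    reflectIf e (reflectIf e p)                                       ≡⟨ reflectIf-involutive e p ⟩
    p                                                                 ∎
    where open ≡-Reasoning

  rotate-mod-+ : ∀ a b p → rotate ((a + b) % N) p ≡ rotate a (rotate b p)
  rotate-mod-+ a b p = trans (rotate-% (a + b) p) (rotate-+ a b p)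

  dihedral-∘ : ∀ a e b f p → rotate ((toℕ a + (if e then (N ∸ toℕ b) % N else toℕ b)) % N) (reflectIf (e xor f) p)
                           ≡ dihedral a e (dihedral b f p)
  dihedral-∘ a false b f p = rotate-mod-+ (toℕ a) (toℕ b) (reflectIf f p)
  dihedral-∘ a true  b f p = begin
    rotate ((toℕ a + (N ∸ toℕ b) % N) % N) (reflectIf (not f) p)     ≡⟨ rotate-mod-+ (toℕ a) _ _ ⟩
    rotate (toℕ a) (rotate ((N ∸ toℕ b) % N) (reflectIf (not f) p)) ≡⟨ cong (rotate (toℕ a)) (rotate-% (N ∸ toℕ b) _) ⟩
    rotate (toℕ a) (rotate (N ∸ toℕ b) (reflectIf (not f) p))        ≡⟨ cong (λ q → rotate (toℕ a) (rotate (N ∸ toℕ b) q)) (sym (reflect-reflectIf f p)) ⟩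
    rotate (toℕ a) (rotate (N ∸ toℕ b) (reflect (reflectIf f p)))   ≡⟨ cong (rotate (toℕ a)) (sym (reflect-rotate (toℕ b) _ (<⇒≤ (toℕ<n b)))) ⟩
    rotate (toℕ a) (reflect (rotate (toℕ b) (reflectIf f p)))       ∎
    where open ≡-Reasoning

  dihedral-rot : ∀ a p → dihedral a false (rot p) ≡ rot (dihedral a false p)
  dihedral-rot a p = rotate-rot (toℕ a) p

  dihedral-reflect-rot : ∀ a p → dihedral a true (rot p) ≡ rot⁻¹ (dihedral a true p)
  dihedral-reflect-rot a p = trans (cong (rotate (toℕ a)) (reflect-rot p)) (rotate-rot⁻¹ (toℕ a) (reflect p))

  -- A rotation never agrees with a reflection, as they act oppositely on orientation.
  rotation≢reflection : 1 ≤ n → ∀ a a' → ¬ (∀ p → dihedral a false p ≡ dihedral a' true p)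
  rotation≢reflection 1≤n a a' same = rot²-≢ 1≤n q (trans (cong rot rot-q≡rot⁻¹-q) (rot-rot⁻¹ q))
    where
    p₀ : Pos
    p₀ = (false , zero)
    q : Pos
    q = dihedral a false p₀
    rot-q≡rot⁻¹-q : rot q ≡ rot⁻¹ q
    rot-q≡rot⁻¹-q = begin
      rot (dihedral a false p₀)    ≡⟨ sym (dihedral-rot a p₀) ⟩
      dihedral a false (rot p₀)    ≡⟨ same (rot p₀) ⟩
      dihedral a' true (rot p₀)    ≡⟨ dihedral-reflect-rot a' p₀ ⟩
      rot⁻¹ (dihedral a' true p₀)  ≡⟨ cong rot⁻¹ (sym (same p₀)) ⟩
      rot⁻¹ (dihedral a false p₀)  ∎
      where open ≡-Reasoning

  -- The amount of rotation is read off the image of a single position.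
  rotation-determined : ∀ e a a' → (∀ p → dihedral a e p ≡ dihedral a' e p) → a ≡ a'
  rotation-determined e a a' same =
    toℕ-injective (trans (sym (index-of a)) (trans (cong posIndex (same (reflectIf e p₀))) (index-of a')))
    where
    p₀ : Pos
    p₀ = (false , zero)
    index-of : ∀ b → posIndex (dihedral b e (reflectIf e p₀)) ≡ toℕ b
    index-of b = begin
      posIndex (rotate (toℕ b) (reflectIf e (reflectIf e p₀))) ≡⟨ cong (λ q → posIndex (rotate (toℕ b) q)) (reflectIf-involutive e p₀) ⟩
      posIndex (rotate (toℕ b) p₀)                             ≡⟨ posIndex-rotate (toℕ b) p₀ ⟩
      (toℕ b + 0) % N                                          ≡⟨ cong (_% N) (+-identityʳ (toℕ b)) ⟩
      toℕ b % N                                                ≡⟨ m<n⇒m%n≡m (toℕ<n b) ⟩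
      toℕ b                                                    ∎
      where open ≡-Reasoning

  dihedral-faithful : 1 ≤ n → ∀ a e a' e' → (∀ p → dihedral a e p ≡ dihedral a' e' p) → a ≡ a' × e ≡ e'
  dihedral-faithful 1≤n a false a' false same = rotation-determined false a a' same , refl
  dihedral-faithful 1≤n a true  a' true  same = rotation-determined true a a' same , refl
  dihedral-faithful 1≤n a false a' true  same = ⊥-elim (rotation≢reflection 1≤n a a' same)
  dihedral-faithful 1≤n a true  a' false same = ⊥-elim (rotation≢reflection 1≤n a' a (λ p → sym (same p)))

-- Vertices of Σ as (layer, position), and vertex maps acting on both separately.
module Vertices (n : ℕ) where

  open Positions n public

  Vertex : Set
  Vertex = V (suc n)

  vertex : Bool → Pos → Vertex
  vertex false (false , c) = x c
  vertex false (true  , c) = y c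
  vertex true  (false , c) = x' c
  vertex true  (true  , c) = y' c

  layer : Vertex → Bool
  layer (x c)  = false
  layer (y c)  = false
  layer (x' c) = true
  layer (y' c) = true

  pos : Vertex → Pos
  pos (x c)  = (false , c)
  pos (y c)  = (true , c)
  pos (x' c) = (false , c)
  pos (y' c) = (true , c)

  vertex-layer-pos : ∀ v → vertex (layer v) (pos v) ≡ v
  vertex-layer-pos (x c)  = refl
  vertex-layer-pos (y c)  = refl
  vertex-layer-pos (x' c) = refl
  vertex-layer-pos (y' c) = refl

  layer-vertex : ∀ u p → layer (vertex u p) ≡ u
  layer-vertex false (false , c) = refl
  layer-vertex false (true  , c) = refl
  layer-vertex true  (false , c) = refl
  layer-vertex true  (true  , c) = refl

  pos-vertex : ∀ u p → pos (vertex u p) ≡ p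
  pos-vertex false (false , c) = refl
  pos-vertex false (true  , c) = refl
  pos-vertex true  (false , c) = refl
  pos-vertex true  (true  , c) = refl

  ≐-vertexwise : {S T : VSet (suc n)} → (∀ u p → S (vertex u p) ≡ T (vertex u p)) → S ≐ T
  ≐-vertexwise {S} {T} eq v =
    subst (λ w → S w ≡ T w) (vertex-layer-pos v) (eq (layer v) (pos v))

  below above : (Pos → Bool) → VSet (suc n)
  below G v = not (layer v) ∧ G (pos v)
  above G v = layer v ∧ G (pos v)

  below-vertex : ∀ G u p → below G (vertex u p) ≡ not u ∧ G p
  below-vertex G false (false , c) = refl
  below-vertex G false (true  , c) = refl
  below-vertex G true  (false , c) = refl
  below-vertex G true  (true  , c) = refl

  above-vertex : ∀ G u p → above G (vertex u p) ≡ u ∧ G p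
  above-vertex G false (false , c) = refl
  above-vertex G false (true  , c) = refl
  above-vertex G true  (false , c) = refl
  above-vertex G true  (true  , c) = refl

  color-pos : ∀ v → color v ≡ proj₂ (pos v)
  color-pos (x c)  = refl
  color-pos (y c)  = refl
  color-pos (x' c) = refl
  color-pos (y' c) = refl

  vmap : (Bool → Bool) → (Pos → Pos) → Vertex → Vertex
  vmap a φ v = vertex (a (layer v)) (φ (pos v))

  vmap-vertex : ∀ a φ u p → vmap a φ (vertex u p) ≡ vertex (a u) (φ p)
  vmap-vertex a φ u p = cong₂ (λ u' p' → vertex (a u') (φ p')) (layer-vertex u p) (pos-vertex u p)

  vmap-∘ : ∀ a φ a' φ' v → vmap a φ (vmap a' φ' v) ≡ vmap (λ u → a (a' u)) (λ p → φ (φ' p)) v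
  vmap-∘ a φ a' φ' v = vmap-vertex a φ (a' (layer v)) (φ' (pos v))

  vmap-cong : ∀ {a a' φ φ'} → (∀ u → a u ≡ a' u) → (∀ p → φ p ≡ φ' p) → ∀ v → vmap a φ v ≡ vmap a' φ' v
  vmap-cong a≡ φ≡ v = cong₂ vertex (a≡ (layer v)) (φ≡ (pos v))

  vmap-id : ∀ {a φ} → (∀ u → a u ≡ u) → (∀ p → φ p ≡ p) → ∀ v → vmap a φ v ≡ v
  vmap-id a≡ φ≡ v = trans (vmap-cong a≡ φ≡ v) (vertex-layer-pos v)

-- The facets of Σ in terms of layers and positions, and its three generating symmetries.
module FacetModel (n : ℕ) where

  open Vertices n public

  -- G chooses one vertex from each antipodal pair: G is a facet of ∂P.
  IsCrossFacet : (Pos → Bool) → Set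
  IsCrossFacet G = ∀ p → G (antipode p) ≡ not (G p)

  IsWindow : (Pos → Bool) → Set
  IsWindow G = Σ[ J ∈ Pos ] (∀ p → G p ≡ window J p)

  -- The facet of Γ_J (the cross-polytope on σ_J ∪ f(σ_J)) taking, in colour c,
  -- the vertex of σ_J if b c and the vertex of f(σ_J) otherwise.
  Γ : Pos → (Colour → Bool) → VSet (suc n)
  Γ J b v = if b (proj₂ (pos v)) then below (window J) v else above (window (rot J)) v

  -- The facet Γ J b contains neither of the edges e_{J-1}, e_J.
  Avoids : Pos → (Colour → Bool) → Set
  Avoids (h , k) b = ¬ (b k ≡ false × b (next k) ≡ true)
                   × ¬ (b (next k) ≡ false × b (next (next k)) ≡ true)

  -- b takes the value t somewhere; for t = false (true) this says that Γ J b is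
  -- not a facet of Δ₁ (of f(Δ₁)).
  Takes : (Colour → Bool) → Bool → Set
  Takes b t = Σ[ c ∈ Colour ] b c ≡ t

  -- The facets of Σ: those of Δ₂, of N and of f(Δ₂).
  data IsFacet (F : VSet (suc n)) : Set where
    lower  : ∀ G → IsCrossFacet G → ¬ IsWindow G → F ≐ below G → IsFacet F
    middle : ∀ J b → Avoids J b → Takes b false → Takes b true → F ≐ Γ J b → IsFacet F
    upper  : ∀ G → IsCrossFacet G → ¬ IsWindow G → F ≐ above G → IsFacet F

  IsFaceP : VSet (suc n) → Set
  IsFaceP S = Σ[ F ∈ VSet (suc n) ] (IsFacet F × S ⊆ F)

  Γ-vertex : ∀ J b u p → Γ J b (vertex u p)
           ≡ (if b (proj₂ p) then not u ∧ window J p else u ∧ window (rot J) p)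
  Γ-vertex J b false (false , c) = refl
  Γ-vertex J b false (true  , c) = refl
  Γ-vertex J b true  (false , c) = refl
  Γ-vertex J b true  (true  , c) = refl

  Symmetry : (Vertex → Vertex) → Set
  Symmetry g = ∀ F → IsFacet F → IsFacet (λ v → F (g v))

  ≐-trans : {S T U : VSet (suc n)} → S ≐ T → T ≐ U → S ≐ U
  ≐-trans S≐T T≐U v = trans (S≐T v) (T≐U v)

  facet-≐ : ∀ {F F' : VSet (suc n)} → F' ≐ F → IsFacet F → IsFacet F'
  facet-≐ eq (lower G cf nw F≐)       = lower G cf nw (≐-trans eq F≐)
  facet-≐ eq (middle J b av tf tt F≐) = middle J b av tf tt (≐-trans eq F≐)
  facet-≐ eq (upper G cf nw F≐)       = upper G cf nw (≐-trans eq F≐)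

  face-≐ : ∀ {S S' : VSet (suc n)} → S' ≐ S → IsFaceP S → IsFaceP S'
  face-≐ eq (F , facet , S⊆F) = F , facet , λ v S'v → S⊆F v (trans (sym (eq v)) S'v)

  symmetry-face : ∀ {g : Vertex → Vertex} → Symmetry g → ∀ S → IsFaceP S → IsFaceP (λ v → S (g v))
  symmetry-face {g} sym-g S (F , facet , S⊆F) = (λ v → F (g v)) , sym-g F facet , λ v → S⊆F (g v)

  symmetry-∘ : ∀ {g h : Vertex → Vertex} → Symmetry g → Symmetry h → Symmetry (λ v → g (h v))
  symmetry-∘ {g} sym-g sym-h F facet = sym-h (λ v → F (g v)) (sym-g F facet)

  symmetry-≐ : ∀ {g h : Vertex → Vertex} → Symmetry g → (∀ v → g v ≡ h v) → Symmetry h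
  symmetry-≐ sym-g g≡h F facet = facet-≐ (λ v → cong F (sym (g≡h v))) (sym-g F facet)

  vmap-id-symmetry : Symmetry (vmap (λ u → u) (λ p → p))
  vmap-id-symmetry F facet = facet-≐ (λ v → cong F (vmap-id (λ _ → refl) (λ _ → refl) v)) facet

  vmap-symmetry-∘ : ∀ a φ a' φ' → Symmetry (vmap a φ) → Symmetry (vmap a' φ')
                  → Symmetry (vmap (λ u → a (a' u)) (λ p → φ (φ' p)))
  vmap-symmetry-∘ a φ a' φ' sym₁ sym₂ = symmetry-≐ (symmetry-∘ sym₁ sym₂) (vmap-∘ a φ a' φ')

  crossFacet-∘ : ∀ {φ : Pos → Pos} {G : Pos → Bool} → (∀ p → φ (antipode p) ≡ antipode (φ p))
               → IsCrossFacet G → IsCrossFacet (λ p → G (φ p))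
  crossFacet-∘ {φ} {G} φ-antipode cf p = trans (cong G (φ-antipode p)) (cf (φ p))

  nonWindow-∘ : ∀ {φ ψ : Pos → Pos} {G : Pos → Bool} → (∀ p → φ (ψ p) ≡ p)
              → (∀ J → Σ[ J' ∈ Pos ] (∀ p → window J (ψ p) ≡ window J' p))
              → ¬ IsWindow G → ¬ IsWindow (λ p → G (φ p))
  nonWindow-∘ {φ} {ψ} {G} φψ ψ-window nw (J , G∘φ≡) =
    nw (proj₁ (ψ-window J) , λ p → trans (cong G (sym (φψ p))) (trans (G∘φ≡ (ψ p)) (proj₂ (ψ-window J) p)))

  pull : ∀ {F F' : VSet (suc n)} a φ → F ≐ F' → ∀ u p → F (vmap a φ (vertex u p)) ≡ F' (vertex (a u) (φ p))
  pull {F} a φ F≐F' u p = trans (cong F (vmap-vertex a φ u p)) (F≐F' _)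

  pull-below : ∀ {F} G a φ → F ≐ below G → ∀ u p → F (vmap a φ (vertex u p)) ≡ not (a u) ∧ G (φ p)
  pull-below G a φ F≐ u p = trans (pull a φ F≐ u p) (below-vertex G (a u) (φ p))

  pull-above : ∀ {F} G a φ → F ≐ above G → ∀ u p → F (vmap a φ (vertex u p)) ≡ a u ∧ G (φ p)
  pull-above G a φ F≐ u p = trans (pull a φ F≐ u p) (above-vertex G (a u) (φ p))

  pull-Γ : ∀ {F} J b a φ → F ≐ Γ J b → ∀ u p → F (vmap a φ (vertex u p))
         ≡ (if b (proj₂ (φ p)) then not (a u) ∧ window J (φ p) else a u ∧ window (rot J) (φ p))
  pull-Γ J b a φ F≐ u p = trans (pull a φ F≐ u p) (Γ-vertex J b (a u) (φ p))

  takes-∘ : ∀ {b t} (φ ψ : Colour → Colour) → (∀ c → φ (ψ c) ≡ c) → Takes b t → Takes (λ c → b (φ c)) t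
  takes-∘ {b} φ ψ φψ (c , bc) = ψ c , trans (cong b (φψ c)) bc

  takes-not : ∀ {b t} → Takes b t → Takes (λ c → not (b c)) (not t)
  takes-not (c , bc) = c , cong not bc

  rot-windows : ∀ J → Σ[ J' ∈ Pos ] (∀ p → window J (rot⁻¹ p) ≡ window J' p)
  rot-windows J = rot J , window-rot⁻¹ J

  rot⁻¹-windows : ∀ J → Σ[ J' ∈ Pos ] (∀ p → window J (rot p) ≡ window J' p)
  rot⁻¹-windows J = rot⁻¹ J , window-rot-left J

  reflect-windows : ∀ J → Σ[ J' ∈ Pos ] (∀ p → window J (reflect p) ≡ window J' p)
  reflect-windows J = mirror J , window-reflect⁻¹ J

  not-not-∧ : ∀ u a → not (not u) ∧ a ≡ u ∧ a
  not-not-∧ u a = cong (_∧ a) (not-involutive u)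

  turn : Vertex → Vertex
  turn = vmap (λ u → u) rot

  turn-avoids : ∀ J b → Avoids J b → Avoids (rot⁻¹ J) (λ c → b (next c))
  turn-avoids (h , k) b av rewrite next-prev k = av

  turn-symmetry : Symmetry turn
  turn-symmetry F (lower G cf nw F≐) =
    lower (λ p → G (rot p)) (crossFacet-∘ rot-antipode cf) (nonWindow-∘ {ψ = rot⁻¹} rot-rot⁻¹ rot-windows nw)
          (≐-vertexwise λ u p → trans (pull-below G (λ u → u) rot F≐ u p) (sym (below-vertex (λ p → G (rot p)) u p)))
  turn-symmetry F (upper G cf nw F≐) =
    upper (λ p → G (rot p)) (crossFacet-∘ rot-antipode cf) (nonWindow-∘ {ψ = rot⁻¹} rot-rot⁻¹ rot-windows nw)
          (≐-vertexwise λ u p → trans (pull-above G (λ u → u) rot F≐ u p) (sym (above-vertex (λ p → G (rot p)) u p)))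
  turn-symmetry F (middle J b av tf tt F≐) =
    middle (rot⁻¹ J) (λ c → b (next c)) (turn-avoids J b av)
           (takes-∘ next prev next-prev tf) (takes-∘ next prev next-prev tt)
           (≐-vertexwise λ u p → trans (pull-Γ J b (λ u → u) rot F≐ u p)
                                       (trans (shift u p) (sym (Γ-vertex (rot⁻¹ J) (λ c → b (next c)) u p))))
    where
    shift : ∀ u p → (if b (proj₂ (rot p)) then not u ∧ window J (rot p) else u ∧ window (rot J) (rot p))
                  ≡ (if b (next (proj₂ p)) then not u ∧ window (rot⁻¹ J) p else u ∧ window (rot (rot⁻¹ J)) p)
    shift u (h , c) = cong₂ (λ X Y → if b (next c) then not u ∧ X else u ∧ Y)
      (window-rot-left J (h , c))
      (trans (window-rot J (h , c)) (cong (λ K → window K (h , c)) (sym (rot-rot⁻¹ J))))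

  swap : Vertex → Vertex
  swap = vmap not (λ p → p)

  differ : ∀ {b : Colour → Bool} {c k} → b c ≡ false → b k ≡ true → c ≢ k
  differ {b} bc bk refl = case trans (sym bc) bk of λ ()

  -- Swapping the layers sends the kept facet Γ J b to a kept facet with the complementary
  -- choices: of Γ_{J-1} if b chooses σ_J in colour J + 1, and of Γ_{J+1} otherwise.
  swap-Γ : ∀ J b → Avoids J b → Σ[ J' ∈ Pos ] (Avoids J' (λ c → not (b c))
         × (∀ u p → (if b (proj₂ p) then not (not u) ∧ window J p else not u ∧ window (rot J) p)
                  ≡ Γ J' (λ c → not (b c)) (vertex u p)))
  swap-Γ (h , k) b (av₁ , av₂) with b (next k) in bnk
  ... | true = rot⁻¹ (h , k) , avoids , λ u p → trans (eq u p) (sym (Γ-vertex _ (λ c → not (b c)) u p))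
    where
    bk : b k ≡ true
    bk = ¬-not (λ bk≡f → av₁ (bk≡f , refl))
    avoids : Avoids (rot⁻¹ (h , k)) (λ c → not (b c))
    avoids rewrite next-prev k | bk | bnk = (λ { (_ , ()) }) , (λ { (_ , ()) })
    eq : ∀ u p → (if b (proj₂ p) then not (not u) ∧ window (h , k) p else not u ∧ window (rot (h , k)) p)
               ≡ (if not (b (proj₂ p)) then not u ∧ window (rot⁻¹ (h , k)) p else u ∧ window (rot (rot⁻¹ (h , k))) p)
    eq u (h' , c) with b c in bc
    ... | true  = trans (not-not-∧ u _) (cong (λ K → u ∧ window K (h' , c)) (sym (rot-rot⁻¹ (h , k))))
    ... | false = cong (not u ∧_) (trans (window-step (h , k) h' c (differ bc bnk))
                                         (sym (window-step⁻¹ (h , k) h' c (differ bc bk))))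
  ... | false = rot (h , k) , avoids , λ u p → trans (eq u p) (sym (Γ-vertex _ (λ c → not (b c)) u p))
    where
    bnnk : b (next (next k)) ≡ false
    bnnk = ¬-not (λ bnnk≡t → av₂ (refl , bnnk≡t))
    avoids : Avoids (rot (h , k)) (λ c → not (b c))
    avoids rewrite bnk | bnnk = (λ { (() , _) }) , (λ { (() , _) })
    eq : ∀ u p → (if b (proj₂ p) then not (not u) ∧ window (h , k) p else not u ∧ window (rot (h , k)) p)
               ≡ (if not (b (proj₂ p)) then not u ∧ window (rot (h , k)) p else u ∧ window (rot (rot (h , k))) p)
    eq u (h' , c) with b c in bc
    ... | true  = trans (not-not-∧ u _) (cong (u ∧_) (sym (trans
                    (window-step (rot (h , k)) h' c (differ bnnk bc ∘ sym))
                    (window-step (h , k) h' c (differ bnk bc ∘ sym)))))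
    ... | false = refl

  swap-symmetry : Symmetry swap
  swap-symmetry F (lower G cf nw F≐) =
    upper G cf nw (≐-vertexwise λ u p → trans (pull-below G not (λ p → p) F≐ u p)
                                              (trans (not-not-∧ u (G p)) (sym (above-vertex G u p))))
  swap-symmetry F (upper G cf nw F≐) =
    lower G cf nw (≐-vertexwise λ u p → trans (pull-above G not (λ p → p) F≐ u p) (sym (below-vertex G u p)))
  swap-symmetry F (middle J b av tf tt F≐) with swap-Γ J b av
  ... | J' , av' , eq = middle J' (λ c → not (b c)) av' (takes-not tt) (takes-not tf)
                         (≐-vertexwise λ u p → trans (pull-Γ J b not (λ p → p) F≐ u p) (eq u p))

  flip : Vertex → Vertex
  flip = vmap not reflect

  -- flip maps Γ J b to Γ at mirror (J + 1), with the reflected and complementary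
  -- choices; the two avoided edges are exchanged.
  flip-avoids : ∀ J b → Avoids J b → Avoids (mirror (rot J)) (λ c → not (b (opposite c)))
  flip-avoids (h , k) b (av₁ , av₂)
    rewrite next-opposite-next (next k) | next-opposite-next k
          | opposite-involutive (next (next k)) | opposite-involutive (next k) | opposite-involutive k
    = (λ (e₁ , e₂) → av₂ (not-flip e₂ , not-flip e₁))
    , (λ (e₁ , e₂) → av₁ (not-flip e₂ , not-flip e₁))

  flip-symmetry : Symmetry flip
  flip-symmetry F (lower G cf nw F≐) =
    upper (λ p → G (reflect p)) (crossFacet-∘ reflect-antipode cf)
          (nonWindow-∘ {ψ = reflect} reflect-reflect reflect-windows nw)
          (≐-vertexwise λ u p → trans (pull-below G not reflect F≐ u p)
                                (trans (not-not-∧ u _) (sym (above-vertex (λ p → G (reflect p)) u p))))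
  flip-symmetry F (upper G cf nw F≐) =
    lower (λ p → G (reflect p)) (crossFacet-∘ reflect-antipode cf)
          (nonWindow-∘ {ψ = reflect} reflect-reflect reflect-windows nw)
          (≐-vertexwise λ u p → trans (pull-above G not reflect F≐ u p) (sym (below-vertex (λ p → G (reflect p)) u p)))
  flip-symmetry F (middle J b av tf tt F≐) =
    middle (mirror (rot J)) b' (flip-avoids J b av)
           (takes-not (takes-∘ opposite opposite opposite-involutive tt))
           (takes-not (takes-∘ opposite opposite opposite-involutive tf))
           (≐-vertexwise λ u p → trans (pull-Γ J b not reflect F≐ u p) (eq u p))
    where
    b' : Colour → Bool
    b' c = not (b (opposite c))
    eq : ∀ u p → (if b (proj₂ (reflect p)) then not (not u) ∧ window J (reflect p) else not u ∧ window (rot J) (reflect p))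
               ≡ Γ (mirror (rot J)) b' (vertex u p)
    eq u (h' , c) = begin
      (if b (opposite c) then not (not u) ∧ window J (reflect (h' , c)) else not u ∧ window (rot J) (reflect (h' , c)))
        ≡⟨ cong₂ (λ X Y → if b (opposite c) then X else Y)
                 (trans (not-not-∧ u _) (cong (u ∧_) (trans (window-reflect⁻¹ J (h' , c))
                                                             (cong (λ K → window K (h' , c)) (sym (rot-mirror-rot J))))))
                 (cong (not u ∧_) (window-reflect⁻¹ (rot J) (h' , c))) ⟩
      (if b (opposite c) then u ∧ window (rot (mirror (rot J))) (h' , c) else not u ∧ window (mirror (rot J)) (h' , c))
        ≡⟨ sym (if-not (b (opposite c))) ⟩
      (if b' c then not u ∧ window (mirror (rot J)) (h' , c) else u ∧ window (rot (mirror (rot J))) (h' , c))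
        ≡⟨ sym (Γ-vertex (mirror (rot J)) b' u (h' , c)) ⟩
      Γ (mirror (rot J)) b' (vertex u (h' , c)) ∎
      where open ≡-Reasoning

-- The model agrees with the paper's definition of Σ (for d = n + 1 ≥ 4).
module Bridge (n : ℕ) (3≤n : 3 ≤ n) where

  open FacetModel n public
  open Construction (suc n) renaming (prev to prevIndex)

  1≤n : 1 ≤ n
  1≤n = ≤-trans (s≤s z≤n) 3≤n

  -- The paper index of the window ending at J (σ_i ends at x_i or y_{i-d}).
  index : Pos → ℕ
  index (false , k) = suc (toℕ k)
  index (true  , k) = suc n + suc (toℕ k)

  toℕ-col : ∀ j → toℕ (col (suc n) (suc j)) ≡ j % suc n
  toℕ-col j = trans (toℕ-fromℕ< _) (trans (cong (_% suc n) (sym (+-suc j n))) ([m+n]%n≡m%n j (suc n)))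

  col-pc : ∀ c → col (suc n) (suc (toℕ c)) ≡ c
  col-pc c = toℕ-injective (trans (toℕ-col (toℕ c)) (m<n⇒m%n≡m (toℕ<n c)))

  col-next : ∀ c → col (suc n) (suc (suc (toℕ c))) ≡ next c
  col-next c = toℕ-injective (trans (toℕ-col (suc (toℕ c))) (next-% c))
    where
    next-% : ∀ c → suc (toℕ c) % suc n ≡ toℕ (next c)
    next-% c with place c
    ... | last    = trans (cong (λ t → suc t % suc n) (toℕ-fromℕ n)) (n%n≡0 (suc n))
    ... | inner c = trans (cong (λ t → suc t % suc n) (toℕ-inject₁ c)) (m<n⇒m%n≡m (s≤s (toℕ<n c)))

  col-last : col (suc n) (suc n) ≡ fromℕ n
  col-last = trans (cong (λ t → col (suc n) (suc t)) (sym (toℕ-fromℕ n))) (col-pc (fromℕ n))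

  col-inner : ∀ c → col (suc n) (suc (toℕ c)) ≡ inject₁ c
  col-inner c = trans (cong (λ t → col (suc n) (suc t)) (sym (toℕ-inject₁ c))) (col-pc (inject₁ c))

  index-Idx : ∀ J → Idx (index J)
  index-Idx (false , k) = s≤s z≤n , ≤-trans (toℕ<n k) (m≤m+n (suc n) (suc n))
  index-Idx (true  , k) = s≤s z≤n , +-monoʳ-≤ (suc n) (toℕ<n k)

  index-onto : ∀ i → Idx i → Σ[ J ∈ Pos ] (index J ≡ i)
  index-onto (suc t) (_ , t<2d) with t ≤? n
  ... | yes t≤n = (false , fromℕ< (s≤s t≤n)) , cong suc (toℕ-fromℕ< (s≤s t≤n))
  ... | no  t≰n = (true , fromℕ< r<d)
                , cong suc (trans (+-suc n _) (trans (cong (λ z → suc n + z) (toℕ-fromℕ< r<d)) (m+[n∸m]≡n d≤t)))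
    where
    d≤t : suc n ≤ t
    d≤t = ≰⇒> t≰n
    r<d : t ∸ suc n < suc n
    r<d = m<n+o⇒m∸n<o t (suc n) t<2d

  cross : (Colour → Bool) → Pos → Bool
  cross ch (h , c) = h xor ch c

  crossFacet-below : ∀ ch → crossFacet ch ≐ below (cross ch)
  crossFacet-below ch (x c)  = refl
  crossFacet-below ch (y c)  = refl
  crossFacet-below ch (x' c) = refl
  crossFacet-below ch (y' c) = refl

  chooseσ-index : ∀ J c → chooseσ (index J) c ≡ proj₁ J xor (c ≤ᶜ proj₂ J)
  chooseσ-index (false , k) c = trans (if-true (≤ᵇ-true (toℕ<n k))) (suc-≤ᵇ (toℕ c) (toℕ k))
  chooseσ-index (true  , k) c = begin
    chooseσ (suc n + suc (toℕ k)) c                 ≡⟨ if-false (≤ᵇ-false (m<m+n (suc n) (s≤s z≤n))) ⟩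
    not (suc (toℕ c) ≤ᵇ suc n + suc (toℕ k) ∸ suc n) ≡⟨ cong (λ t → not (suc (toℕ c) ≤ᵇ t)) (m+n∸m≡n (suc n) (suc (toℕ k))) ⟩
    not (suc (toℕ c) ≤ᵇ suc (toℕ k))                 ≡⟨ cong not (suc-≤ᵇ (toℕ c) (toℕ k)) ⟩
    not (c ≤ᶜ k)                                     ∎
    where open ≡-Reasoning

  sigma-index : ∀ J → sigma (index J) ≐ below (window J)
  sigma-index J v = trans (crossFacet-below (chooseσ (index J)) v) (cong (not (layer v) ∧_) (cross-chooseσ (pos v)))
    where
    cross-chooseσ : ∀ p → cross (chooseσ (index J)) p ≡ window J p
    cross-chooseσ (h' , c) = trans (cong (h' xor_) (chooseσ-index J c)) (sym (xor-assoc h' (proj₁ J) (c ≤ᶜ proj₂ J)))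

  -- f and f⁻¹ advance the position by one step and change the layer; fhat-wrap treats
  -- the wrap-around from colour d to colour 1.
  fhat-wrap : ∀ h c → (if isLast c then vertex true (not h , col (suc n) 1)
                                  else vertex true (h , col (suc n) (suc (toℕ c) + 1)))
                    ≡ vertex true (rot (h , c))
  fhat-wrap h c with isLast c in last?
  ... | true  = cong₂ (λ a b → vertex true (a , b)) (sym (xor-comm h true)) (trans (col-pc zero) (sym (next-isLast c last?)))
  ... | false = cong₂ (λ a b → vertex true (a , b)) (sym (xor-identityʳ h))
                      (trans (cong (col (suc n)) (+-comm (suc (toℕ c)) 1)) (col-next c))

  fhat-lower : ∀ p → fhat (vertex false p) ≡ vertex true (rot p)
  fhat-lower (false , c) = trans (cong (λ b → if b then y' (col (suc n) 1) else x' (col (suc n) (suc (toℕ c) + 1)))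
                                       (sym (isLast-toℕ c))) (fhat-wrap false c)
  fhat-lower (true , c)  = trans (cong (λ b → if b then x' (col (suc n) 1) else y' (col (suc n) (suc (toℕ c) + 1)))
                                       (sym (isLast-toℕ c))) (fhat-wrap true c)

  fhat-upper : ∀ p → fhat (vertex true p) ≡ vertex false (rot⁻¹ p)
  fhat-upper (false , zero)  = cong y col-last
  fhat-upper (false , suc c) = cong x (col-inner c)
  fhat-upper (true  , zero)  = cong x col-last
  fhat-upper (true  , suc c) = cong y (col-inner c)

  fimg-below : ∀ G → fimg (below G) ≐ above (λ p → G (rot⁻¹ p))
  fimg-below G = ≐-vertexwise λ where
    false p → trans (cong (below G) (fhat-lower p))
                    (trans (below-vertex G true (rot p)) (sym (above-vertex (λ p → G (rot⁻¹ p)) false p)))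
    true  p → trans (cong (below G) (fhat-upper p))
                    (trans (below-vertex G false (rot⁻¹ p)) (sym (above-vertex (λ p → G (rot⁻¹ p)) true p)))

  fimg-sigma-index : ∀ J → fimg (sigma (index J)) ≐ above (window (rot J))
  fimg-sigma-index J v = begin
    sigma (index J) (fhat v)       ≡⟨ sigma-index J (fhat v) ⟩
    below (window J) (fhat v)      ≡⟨ fimg-below (window J) v ⟩
    layer v ∧ window J (rot⁻¹ (pos v)) ≡⟨ cong (layer v ∧_) (window-rot⁻¹ J (pos v)) ⟩
    above (window (rot J)) v       ∎
    where open ≡-Reasoning

  ΓF-index : ∀ J b → ΓF (index J) b ≐ Γ J b
  ΓF-index J b v = trans (cong (λ c → if b c then sigma (index J) v else fimg (sigma (index J)) v) (color-pos v))
                         (if-cong₂ (b (proj₂ (pos v))) (sigma-index J v) (fimg-sigma-index J v))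

  prev-index : ∀ J → prevIndex (index J) ≡ index (rot⁻¹ J)
  prev-index (false , zero)  = cong (λ t → suc n + suc t) (sym (toℕ-fromℕ n))
  prev-index (false , suc k) = cong suc (sym (toℕ-inject₁ k))
  prev-index (true  , zero)  = trans (if-false (≡ᵇ-false (λ e → 1+n≢0 (trans (sym (+-suc n 0)) (suc-injective e)))))
                                     (trans (+-comm n 1) (cong suc (sym (toℕ-fromℕ n))))
  prev-index (true  , suc k) = trans (if-false (≡ᵇ-false (λ e → 1+n≢0 (trans (sym (+-suc n _)) (suc-injective e)))))
                                     (trans (+-suc n (suc (toℕ k))) (cong (λ t → suc n + suc t) (sym (toℕ-inject₁ k))))

  E-early : ∀ i → 1 ≤ i → i ≤ n ∸ 1 → E i ≡ (X' (suc n) (i + 1) , Y (suc n) (i + 2))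
  E-early i 1≤i i≤ rewrite ≤ᵇ-true 1≤i | ≤ᵇ-true i≤ = refl

  E-at-n : E n ≡ (X' (suc n) (suc n) , X (suc n) 1)
  E-at-n rewrite ≤ᵇ-false {n} {n ∸ 1} (∸-monoʳ-< {n = 1} ≤-refl 1≤n) | ∧-zeroʳ (1 ≤ᵇ n) | ≡ᵇ-true {n} refl = refl

  E-at-d : E (suc n) ≡ (Y' (suc n) 1 , X (suc n) 2)
  E-at-d rewrite ≤ᵇ-false {suc n} {n ∸ 1} (s≤s (m∸n≤m n 1)) | ≡ᵇ-false {suc n} {n} 1+n≢n | ≡ᵇ-true {n} refl = refl

  E-late : ∀ i → suc n < i → i ≤ n + n → E i ≡ (Y' (suc n) (i ∸ suc n + 1) , X (suc n) (i ∸ suc n + 2))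
  E-late i d<i i≤2n
    rewrite ≤ᵇ-false {i} {n ∸ 1} (≤-trans (s≤s (m∸n≤m n 1)) (<⇒≤ d<i)) | ∧-zeroʳ (1 ≤ᵇ i)
          | ≡ᵇ-false {i} {n} (λ { refl → <-asym d<i (n<1+n n) })
          | ≡ᵇ-false {i} {suc n} (λ { refl → <-irrefl refl d<i })
          | ≤ᵇ-true {i} {n + suc n ∸ 1} (subst (i ≤_) (sym (cong (_∸ 1) (+-suc n n))) i≤2n)
    = refl

  E-at-2d-1 : E (suc (n + n)) ≡ (Y' (suc n) (suc n) , Y (suc n) 1)
  E-at-2d-1
    rewrite ≤ᵇ-false {suc (n + n)} {n ∸ 1} (s≤s (≤-trans (m∸n≤m n 1) (m≤m+n n n))) | ∧-zeroʳ (1 ≤ᵇ suc (n + n))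
          | ≡ᵇ-false {suc (n + n)} {n} (λ e → <-irrefl (sym e) (s≤s (m≤m+n n n)))
          | ≡ᵇ-false {suc (n + n)} {suc n} (λ e → <-irrefl (sym (suc-injective e)) (m<m+n n 1≤n))
          | ≤ᵇ-false {suc (n + n)} {n + suc n ∸ 1} (s≤s (≤-reflexive (cong (_∸ 1) (+-suc n n))))
          | ≡ᵇ-true {suc (n + n)} {n + suc n} (sym (+-suc n n))
    = refl

  E-at-2d : E (suc n + suc n) ≡ (X' (suc n) 1 , Y (suc n) 2)
  E-at-2d
    rewrite ≤ᵇ-false {suc n + suc n} {n ∸ 1} (s≤s (≤-trans (m∸n≤m n 1) (m≤m+n n (suc n)))) | ∧-zeroʳ (1 ≤ᵇ suc n + suc n)
          | ≡ᵇ-false {suc n + suc n} {n} (λ e → <-irrefl (sym e) (s≤s (m≤m+n n (suc n))))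
          | ≡ᵇ-false {suc n + suc n} {suc n} (λ e → <-irrefl (sym (suc-injective e)) (m<m+n n (s≤s z≤n)))
          | ≤ᵇ-false {suc n + suc n} {n + suc n ∸ 1} (s≤s (m∸n≤m (n + suc n) 1))
          | ≡ᵇ-false {suc n + suc n} {n + suc n} 1+n≢n
    = refl

  edge : Pos → Vertex × Vertex
  edge J = (vertex true (rot J) , vertex false (antipode (rot (rot J))))

  E-index-x : ∀ k → E (index (false , k)) ≡ edge (false , k)
  E-index-x k with place k
  ... | last = trans (cong (λ t → E (suc t)) (toℕ-fromℕ n))
                     (trans E-at-d (cong₂ _,_ (cong y' (col-pc zero)) far-end))
    where
    far-end : x (col (suc n) 2) ≡ vertex false (antipode (rot (true , zero)))
    far-end rewrite isLast-zero 1≤n = cong x (col-next zero)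
  ... | inner k with isLast (suc k) in last?
  ...   | true  = trans (cong E (trans (cong suc (toℕ-inject₁ k)) (toℕ-isLast (suc k) last?)))
                        (trans E-at-n (cong₂ _,_
                          (cong x' (trans (cong (col (suc n)) (sym (cong suc (toℕ-isLast (suc k) last?)))) (col-pc (suc k))))
                          (cong x (trans (col-pc zero) (sym (next-isLast (suc k) last?))))))
  ...   | false = trans (E-early _ (s≤s z≤n) i≤n-1)
                        (cong₂ _,_ (cong x' (trans (cong (col (suc n)) i+1≡) (col-pc (suc k))))
                                   (cong y (trans (cong (col (suc n)) i+2≡) (col-next (suc k)))))
    where
    i+1≡ : suc (toℕ (inject₁ k)) + 1 ≡ suc (suc (toℕ k))
    i+1≡ = trans (+-comm _ 1) (cong (λ t → suc (suc t)) (toℕ-inject₁ k))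
    i+2≡ : suc (toℕ (inject₁ k)) + 2 ≡ suc (suc (suc (toℕ k)))
    i+2≡ = trans (+-comm _ 2) (cong (λ t → suc (suc (suc t))) (toℕ-inject₁ k))
    i≤n-1 : suc (toℕ (inject₁ k)) ≤ n ∸ 1
    i≤n-1 = ∸-monoˡ-≤ 1 (s≤s⁻¹ (subst (_< suc n)
                               (trans (toℕ-next (suc k) last?) (cong (λ t → suc (suc t)) (sym (toℕ-inject₁ k))))
                               (toℕ<n (next (suc k)))))

  E-index-y : ∀ k → E (index (true , k)) ≡ edge (true , k)
  E-index-y k with place k
  ... | last = trans (cong (λ t → E (suc n + suc t)) (toℕ-fromℕ n))
                     (trans E-at-2d (cong₂ _,_ (cong x' (col-pc zero)) far-end))
    where
    far-end : y (col (suc n) 2) ≡ vertex false (antipode (rot (false , zero)))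
    far-end rewrite isLast-zero 1≤n = cong y (col-next zero)
  ... | inner k with isLast (suc k) in last?
  ...   | true  = trans (cong E (trans (cong (λ t → suc n + suc t) (toℕ-inject₁ k))
                                       (cong (suc n +_) (toℕ-isLast (suc k) last?))))
                        (trans E-at-2d-1 (cong₂ _,_
                          (cong y' (trans (cong (col (suc n)) (sym (cong suc (toℕ-isLast (suc k) last?)))) (col-pc (suc k))))
                          (cong y (trans (col-pc zero) (sym (next-isLast (suc k) last?))))))
  ...   | false = trans (E-late _ (m<m+n (suc n) (s≤s z≤n)) i≤2n)
                        (cong₂ _,_ (cong y' (trans (cong (col (suc n)) i-d+1≡) (col-pc (suc k))))
                                   (cong x (trans (cong (col (suc n)) i-d+2≡) (col-next (suc k)))))
    where
    t = toℕ (inject₁ k)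
    i-d+1≡ : suc n + suc t ∸ suc n + 1 ≡ suc (suc (toℕ k))
    i-d+1≡ = trans (cong (_+ 1) (m+n∸m≡n (suc n) (suc t)))
                   (trans (+-comm (suc t) 1) (cong (λ z → suc (suc z)) (toℕ-inject₁ k)))
    i-d+2≡ : suc n + suc t ∸ suc n + 2 ≡ suc (suc (suc (toℕ k)))
    i-d+2≡ = trans (cong (_+ 2) (m+n∸m≡n (suc n) (suc t)))
                   (trans (+-comm (suc t) 2) (cong (λ z → suc (suc (suc z))) (toℕ-inject₁ k)))
    t+2≤n : suc (suc t) ≤ n
    t+2≤n = s≤s⁻¹ (subst (_< suc n) (trans (toℕ-next (suc k) last?) (cong (λ z → suc (suc z)) (sym (toℕ-inject₁ k))))
                                    (toℕ<n (next (suc k))))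
    i≤2n : suc n + suc t ≤ n + n
    i≤2n = subst (_≤ n + n) (+-suc n (suc t)) (+-monoʳ-≤ n t+2≤n)

  E-index : ∀ J → E (index J) ≡ edge J
  E-index (false , k) = E-index-x k
  E-index (true  , k) = E-index-y k

  prev-edge : ∀ J → E (prevIndex (index J)) ≡ (vertex true J , vertex false (antipode (rot J)))
  prev-edge J = trans (cong E (prev-index J))
                      (trans (E-index (rot⁻¹ J)) (cong (λ K → vertex true K , vertex false (antipode (rot K))) (rot-rot⁻¹ J)))

  Γ-upper-point : ∀ J b q → window (rot J) q ≡ true → Γ J b (vertex true q) ≡ not (b (proj₂ q))
  Γ-upper-point J b q w with b (proj₂ q) | Γ-vertex J b true q
  ... | true  | Γ≡ = Γ≡
  ... | false | Γ≡ = trans Γ≡ w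

  Γ-lower-point : ∀ J b q → window J q ≡ true → Γ J b (vertex false q) ≡ b (proj₂ q)
  Γ-lower-point J b q w with b (proj₂ q) | Γ-vertex J b false q
  ... | true  | Γ≡ = trans Γ≡ w
  ... | false | Γ≡ = Γ≡

  contains⇔ : ∀ {F : VSet (suc n)} {u w a c} → F u ≡ not a → F w ≡ c → Contains F (u , w) ⇔ (a ≡ false × c ≡ true)
  contains⇔ Fu≡ Fw≡ = mk⇔ (λ (e₁ , e₂) → not-flip (trans (sym Fu≡) e₁) , trans (sym Fw≡) e₂)
                          (λ (a≡ , c≡) → trans Fu≡ (cong not a≡) , trans Fw≡ c≡)

  contains-prev-edge : ∀ h k b → Contains (ΓF (index (h , k)) b) (E (prevIndex (index (h , k))))
                                 ⇔ (b k ≡ false × b (next k) ≡ true)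
  contains-prev-edge h k b = subst (λ e → Contains (ΓF (index J) b) e ⇔ _) (sym (prev-edge J))
    (contains⇔ {ΓF (index J) b} {vertex true J} {vertex false (antipode (rot J))} at-upper at-lower)
    where
    J = (h , k)
    at-upper : ΓF (index J) b (vertex true J) ≡ not (b k)
    at-upper = trans (ΓF-index J b (vertex true J)) (Γ-upper-point J b J (window-rot-self 1≤n J))
    at-lower : ΓF (index J) b (vertex false (antipode (rot J))) ≡ b (next k)
    at-lower = trans (ΓF-index J b (vertex false (antipode (rot J)))) (Γ-lower-point J b (antipode (rot J)) (window-antipode-rot J))

  contains-edge : ∀ h k b → Contains (ΓF (index (h , k)) b) (E (index (h , k)))
                            ⇔ (b (next k) ≡ false × b (next (next k)) ≡ true)
  contains-edge h k b = subst (λ e → Contains (ΓF (index J) b) e ⇔ _) (sym (E-index J))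
    (contains⇔ {ΓF (index J) b} {vertex true (rot J)} {vertex false (antipode (rot (rot J)))} at-upper at-lower)
    where
    J = (h , k)
    at-upper : ΓF (index J) b (vertex true (rot J)) ≡ not (b (next k))
    at-upper = trans (ΓF-index J b (vertex true (rot J))) (Γ-upper-point J b (rot J) (window-self (rot J)))
    at-lower : ΓF (index J) b (vertex false (antipode (rot (rot J)))) ≡ b (next (next k))
    at-lower = trans (ΓF-index J b (vertex false (antipode (rot (rot J)))))
                     (Γ-lower-point J b (antipode (rot (rot J))) (window-antipode-rot² 1≤n J))

  kept⇔avoids : ∀ J b → Kept (index J) b ⇔ Avoids J b
  kept⇔avoids (h , k) b = mk⇔
    (λ (k₁ , k₂) → k₁ ∘ Equivalence.from (contains-prev-edge h k b) , k₂ ∘ Equivalence.from (contains-edge h k b))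
    (λ (a₁ , a₂) → a₁ ∘ Equivalence.to (contains-prev-edge h k b) , a₂ ∘ Equivalence.to (contains-edge h k b))

  window-hits : ∀ J c → Σ[ h ∈ Bool ] window J (h , c) ≡ true
  window-hits J c with window J (false , c) in w
  ... | true  = false , w
  ... | false = true , trans (window-antipode J (false , c)) (cong not w)

  sigma-upper : ∀ j q → sigma j (vertex true q) ≡ false
  sigma-upper j (false , c) = refl
  sigma-upper j (true  , c) = refl

  fimg-sigma-lower : ∀ j q → fimg (sigma j) (vertex false q) ≡ false
  fimg-sigma-lower j q = trans (cong (sigma j) (fhat-lower q)) (sigma-upper j (rot q))

  takes-false⇒∉Δ₁ : ∀ J b → Takes b false → ¬ InΔ₁ (ΓF (index J) b)
  takes-false⇒∉Δ₁ J b (c , bc) (j , _ , Γ⊆σ) with window-hits (rot J) c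
  ... | h , w = case trans (sym (sigma-upper j (h , c))) (Γ⊆σ (vertex true (h , c)) Γq) of λ ()
    where
    Γq : ΓF (index J) b (vertex true (h , c)) ≡ true
    Γq = trans (ΓF-index J b (vertex true (h , c))) (trans (Γ-upper-point J b (h , c) w) (cong not bc))

  takes-true⇒∉fΔ₁ : ∀ J b → Takes b true → ¬ InfΔ₁ (ΓF (index J) b)
  takes-true⇒∉fΔ₁ J b (c , bc) (j , _ , Γ⊆fσ) with window-hits J c
  ... | h , w = case trans (sym (fimg-sigma-lower j (h , c))) (Γ⊆fσ (vertex false (h , c)) Γq) of λ ()
    where
    Γq : ΓF (index J) b (vertex false (h , c)) ≡ true
    Γq = trans (ΓF-index J b (vertex false (h , c))) (trans (Γ-lower-point J b (h , c) w) bc)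

  -- Conversely, by decidability of the finitely many choices.
  ∉Δ₁⇒takes-false : ∀ J b → ¬ InΔ₁ (ΓF (index J) b) → Takes b false
  ∉Δ₁⇒takes-false J b ∉Δ₁ with ¬∀⟶∃¬ (suc n) (λ c → b c ≡ true) (λ c → b c ≟ true) all-true⇒Δ₁
    where
    all-true⇒Δ₁ : ¬ (∀ c → b c ≡ true)
    all-true⇒Δ₁ all = ∉Δ₁ (index J , index-Idx J , λ v Γv →
      subst (λ t → (if t then sigma (index J) v else fimg (sigma (index J)) v) ≡ true) (all (color v)) Γv)
  ... | c , bc≢true = c , ¬-not bc≢true

  ∉fΔ₁⇒takes-true : ∀ J b → ¬ InfΔ₁ (ΓF (index J) b) → Takes b true
  ∉fΔ₁⇒takes-true J b ∉fΔ₁ with ¬∀⟶∃¬ (suc n) (λ c → b c ≡ false) (λ c → b c ≟ false) all-false⇒fΔ₁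
    where
    all-false⇒fΔ₁ : ¬ (∀ c → b c ≡ false)
    all-false⇒fΔ₁ all = ∉fΔ₁ (index J , index-Idx J , λ v Γv →
      subst (λ t → (if t then sigma (index J) v else fimg (sigma (index J)) v) ≡ true) (all (color v)) Γv)
  ... | c , bc≢false = c , ¬-not bc≢false

  cross-isCrossFacet : ∀ ch → IsCrossFacet (cross ch)
  cross-isCrossFacet ch (h , c) = sym (not-distribˡ-xor h (ch c))

  choice : (Pos → Bool) → Colour → Bool
  choice G c = G (false , c)

  cross-choice : ∀ {G} → IsCrossFacet G → ∀ p → cross (choice G) p ≡ G p
  cross-choice cf (false , c) = refl
  cross-choice cf (true  , c) = sym (cf (false , c))

  window-of-cross : ∀ {G} → IsCrossFacet G → IsWindow (cross (choice G)) → IsWindow G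
  window-of-cross cf (J , eq) = J , λ p → trans (sym (cross-choice cf p)) (eq p)

  window⇒sigma : ∀ ch → IsWindow (cross ch) → IsSigma ch
  window⇒sigma ch (J , cross≡) = index J , index-Idx J , λ v →
    trans (crossFacet-below ch v) (trans (cong (not (layer v) ∧_) (cross≡ (pos v))) (sym (sigma-index J v)))

  sigma⇒window : ∀ ch → IsSigma ch → IsWindow (cross ch)
  sigma⇒window ch (i , idx , cf≐σ) with index-onto i idx
  ... | J , refl = J , λ p → trans (sym (trans (crossFacet-below ch (vertex false p)) (below-vertex (cross ch) false p)))
                                   (trans (cf≐σ (vertex false p))
                                          (trans (sigma-index J (vertex false p)) (below-vertex (window J) false p)))

  fimg-cross : ∀ ch → fimg (crossFacet ch) ≐ above (λ p → cross ch (rot⁻¹ p))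
  fimg-cross ch v = trans (crossFacet-below ch (fhat v)) (fimg-below (cross ch) v)

  ⊆-≐ : ∀ {S F F' : VSet (suc n)} → S ⊆ F → F ≐ F' → S ⊆ F'
  ⊆-≐ S⊆F F≐F' v Sv = trans (sym (F≐F' v)) (S⊆F v Sv)

  face⇒faceP : ∀ S → IsFace S → IsFaceP S
  face⇒faceP S (inj₁ (ch , ¬σ , S⊆)) =
    crossFacet ch , lower (cross ch) (cross-isCrossFacet ch) (¬σ ∘ window⇒sigma ch) (crossFacet-below ch) , S⊆
  face⇒faceP S (inj₂ (inj₁ (i , b , idx , kept , ∉Δ₁ , ∉fΔ₁ , S⊆))) with index-onto i idx
  ... | J , refl = ΓF (index J) b
                 , middle J b (Equivalence.to (kept⇔avoids J b) kept) (∉Δ₁⇒takes-false J b ∉Δ₁) (∉fΔ₁⇒takes-true J b ∉fΔ₁)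
                          (ΓF-index J b)
                 , S⊆
  face⇒faceP S (inj₂ (inj₂ (ch , ¬σ , S⊆))) =
    fimg (crossFacet ch)
    , upper (λ p → cross ch (rot⁻¹ p)) (crossFacet-∘ {φ = rot⁻¹} rot⁻¹-antipode (cross-isCrossFacet ch))
            (nonWindow-∘ {φ = rot⁻¹} {ψ = rot} rot⁻¹-rot rot⁻¹-windows (¬σ ∘ window⇒sigma ch)) (fimg-cross ch)
    , S⊆

  faceP⇒face : ∀ S → IsFaceP S → IsFace S
  faceP⇒face S (F , lower G cf nw F≐ , S⊆F) =
    inj₁ (choice G , nw ∘ window-of-cross cf ∘ sigma⇒window (choice G)
         , ⊆-≐ S⊆F λ v → trans (F≐ v) (trans (cong (not (layer v) ∧_) (sym (cross-choice cf (pos v))))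
                                              (sym (crossFacet-below (choice G) v))))
  faceP⇒face S (F , middle J b av tf tt F≐ , S⊆F) =
    inj₂ (inj₁ (index J , b , index-Idx J , Equivalence.from (kept⇔avoids J b) av
               , takes-false⇒∉Δ₁ J b tf , takes-true⇒∉fΔ₁ J b tt
               , ⊆-≐ S⊆F λ v → trans (F≐ v) (sym (ΓF-index J b v))))
  faceP⇒face S (F , upper G cf nw F≐ , S⊆F) =
    inj₂ (inj₂ (choice G' , nw' ∘ window-of-cross cf' ∘ sigma⇒window (choice G')
               , ⊆-≐ S⊆F λ v → trans (F≐ v) (sym (fimg-G' v))))
    where
    G' : Pos → Bool
    G' p = G (rot p)
    cf' : IsCrossFacet G'
    cf' = crossFacet-∘ rot-antipode cf
    nw' : ¬ IsWindow G'
    nw' = nonWindow-∘ {φ = rot} {ψ = rot⁻¹} rot-rot⁻¹ rot-windows nw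
    fimg-G' : fimg (crossFacet (choice G')) ≐ above G
    fimg-G' v = trans (fimg-cross (choice G') v)
                      (cong (layer v ∧_) (trans (cross-choice cf' (rot⁻¹ (pos v))) (cong G (rot-rot⁻¹ (pos v)))))

module Action (n : ℕ) (3≤n : 3 ≤ n) where

  open Bridge n 3≤n public
  open Dihedral n using (N; rotate; reflectIf; dihedral; dihedral⁻¹; dihedral-dihedral⁻¹; dihedral⁻¹-dihedral;
                         dihedral-∘; dihedral-faithful)
  open Group (suc n) using (G; _·_; addR; negR)
  open Construction (suc n) using (IsAut)

  act act⁻¹ : G → Vertex → Vertex
  act   (z , a , e) = vmap (z xor_) (dihedral a e)
  act⁻¹ (z , a , e) = vmap (z xor_) (dihedral⁻¹ a e)

  act-act⁻¹ : ∀ g v → act g (act⁻¹ g v) ≡ v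
  act-act⁻¹ (z , a , e) v = trans (vmap-∘ (z xor_) (dihedral a e) (z xor_) (dihedral⁻¹ a e) v)
                                  (vmap-id (xor-cancelˡ z) (dihedral-dihedral⁻¹ a e) v)

  act⁻¹-act : ∀ g v → act⁻¹ g (act g v) ≡ v
  act⁻¹-act (z , a , e) v = trans (vmap-∘ (z xor_) (dihedral⁻¹ a e) (z xor_) (dihedral a e) v)
                                  (vmap-id (xor-cancelˡ z) (dihedral⁻¹-dihedral a e) v)

  toℕ-product : ∀ a e b → toℕ (addR a (if e then negR b else b))
                        ≡ (toℕ a + (if e then (N ∸ toℕ b) % N else toℕ b)) % N
  toℕ-product a false b = toℕ-fromℕ< _
  toℕ-product a true  b = trans (toℕ-fromℕ< _) (cong (λ t → (toℕ a + t) % N) (toℕ-fromℕ< _))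

  act-∘ : ∀ g h v → act (g · h) v ≡ act g (act h v)
  act-∘ (z , a , e) (z' , b , f) v =
    trans (vmap-cong (xor-assoc z z')
                     (λ p → trans (cong (λ k → rotate k (reflectIf (e xor f) p)) (toℕ-product a e b))
                                  (dihedral-∘ a e b f p)) v)
          (sym (vmap-∘ (z xor_) (dihedral a e) (z' xor_) (dihedral b f) v))

  -- Every group element acts by a composite of turn, swap and flip.
  rotate-symmetry : ∀ k → Symmetry (vmap (λ u → u) (rotate k))
  rotate-symmetry zero    = vmap-id-symmetry
  rotate-symmetry (suc k) = vmap-symmetry-∘ (λ u → u) rot (λ u → u) (rotate k) turn-symmetry (rotate-symmetry k)

  reflectIf-symmetry : ∀ e → Symmetry (vmap (λ u → u) (reflectIf e))
  reflectIf-symmetry false = vmap-id-symmetry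
  reflectIf-symmetry true  = symmetry-≐ (vmap-symmetry-∘ not (λ p → p) not reflect swap-symmetry flip-symmetry)
                                        (vmap-cong {φ = reflect} not-involutive (λ _ → refl))

  swapIf-symmetry : ∀ z → Symmetry (vmap (z xor_) (λ p → p))
  swapIf-symmetry false = vmap-id-symmetry
  swapIf-symmetry true  = swap-symmetry

  act-symmetry : ∀ g → Symmetry (act g)
  act-symmetry (z , a , e) =
    vmap-symmetry-∘ (z xor_) (λ p → p) (λ u → u) (dihedral a e) (swapIf-symmetry z)
      (vmap-symmetry-∘ (λ u → u) (rotate (toℕ a)) (λ u → u) (reflectIf e)
                       (rotate-symmetry (toℕ a)) (reflectIf-symmetry e))

  act⁻¹-symmetry : ∀ g → Symmetry (act⁻¹ g)
  act⁻¹-symmetry (z , a , e) =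
    vmap-symmetry-∘ (λ u → u) (reflectIf e) (z xor_) (rotate (N ∸ toℕ a)) (reflectIf-symmetry e)
      (vmap-symmetry-∘ (λ u → u) (rotate (N ∸ toℕ a)) (z xor_) (λ p → p)
                       (rotate-symmetry (N ∸ toℕ a)) (swapIf-symmetry z))

  automorphism : (φ : Vertex ↔ Vertex) → Symmetry (Inverse.to φ) → Symmetry (Inverse.from φ)
               → (∀ v → Inverse.from φ (Inverse.to φ v) ≡ v) → IsAut φ
  automorphism φ sym-to sym-from from-to S =
      (λ face → faceP⇒face _ (symmetry-face sym-from S (face⇒faceP S face)))
    , (λ face → faceP⇒face S (face-≐ (λ v → cong S (sym (from-to v)))
                                      (symmetry-face sym-to _ (face⇒faceP _ face))))

  action : G → Vertex ↔ Vertex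
  action g = mk↔ₛ′ (act g) (act⁻¹ g) (act-act⁻¹ g) (act⁻¹-act g)

  action-aut : ∀ g → IsAut (action g)
  action-aut g = automorphism (action g) (act-symmetry g) (act⁻¹-symmetry g) (act⁻¹-act g)

  layer-act : ∀ z a e p → layer (act (z , a , e) (vertex false p)) ≡ z
  layer-act z a e p = trans (cong layer (vmap-vertex (z xor_) (dihedral a e) false p))
                            (trans (layer-vertex _ _) (xor-identityʳ z))

  pos-act : ∀ z a e p → pos (act (z , a , e) (vertex false p)) ≡ dihedral a e p
  pos-act z a e p = trans (cong pos (vmap-vertex (z xor_) (dihedral a e) false p)) (pos-vertex _ _)

  action-faithful : ∀ g h → (∀ v → act g v ≡ act h v) → g ≡ h
  action-faithful (z , a , e) (z' , a' , e') same
    with dihedral-faithful 1≤n a e a' e' (λ p → trans (sym (pos-act z a e p))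
                                                (trans (cong pos (same (vertex false p))) (pos-act z' a' e' p)))
  ... | refl , refl = cong (_, a , e) (trans (sym (layer-act z a e p₀))
                                             (trans (cong layer (same (vertex false p₀))) (layer-act z' a e p₀)))
    where
    p₀ : Pos
    p₀ = (false , zero)

mainTheorem9 : (d : ℕ) → .{{_ : NonZero d}} → 4 ≤ d →
    Σ[ ρ ∈ (Group.G d → V d ↔ V d) ]
      ((∀ g → Construction.IsAut d (ρ g))
      × (∀ g h v → Inverse.to (ρ (Group._·_ d g h)) v
                   ≡ Inverse.to (ρ g) (Inverse.to (ρ h) v))
      × (∀ g h → (∀ v → Inverse.to (ρ g) v ≡ Inverse.to (ρ h) v) → g ≡ h))
mainTheorem9 (suc n) (s≤s 3≤n) = action , action-aut , act-∘ , action-faithful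
  where open Action n 3≤n
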